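{- Let $M=p_i^{n_i}p_j^{n_j}p_k^{n_k}$ with distinct primes $p_i,p_j,p_k$ and $n_i,n_j,n_k\ge1$, and suppose $p_\nu=2$ for some $\nu\in\{i,j,k\}$. Let $A\subset\mathbb{Z}_M$ (not necessarily a tile) with $\Phi_M\mid A$, and let $\Lambda$ be a $D(M)$-grid such that $A\cap\Lambda$ is not a union of pairwise disjoint $M$-fibers. Then, identifying $\Lambda$ with $\mathbb{Z}_{p_i}\times\mathbb{Z}_{p_j}\times\mathbb{Z}_{p_k}$, $A\cap\Lambda$ is the union of one set of diagonal boxes $A_1=(I_1\times J_1\times K_1)\cup(I_1^c\times J_1^c\times K_1^c)$, where $I_1\subset\mathbb{Z}_{p_i},J_1\subset\mathbb{Z}_{p_j},K_1\subset\mathbb{Z}_{p_k}$ are nonempty with nonempty complements $I_1^c=\mathbb{Z}_{p_i}\setminus I_1$, $J_1^c=\mathbb{Z}_{p_j}\setminus J_1$, $K_1^c=\mathbb{Z}_{p_k}\setminus K_1$, and possibly additional $M$-fibers in one or more directions, disjoint from $A_1$ and from each other.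
   Context: "$\Phi_M\mid A$" means the $M$-th cyclotomic polynomial divides $A(X)=\sum_{a\in A}X^a$. $D(M)=p_i^{n_i-1}p_j^{n_j-1}p_k^{n_k-1}$; a $D(M)$-grid is $\Lambda=\Lambda(x_0,D(M))=\{x\in\mathbb{Z}_M:D(M)\mid x-x_0\}$, which has $p_ip_jp_k$ elements $x_0+\lambda_iM/p_i+\lambda_jM/p_j+\lambda_kM/p_k$, identified with $(\lambda_i,\lambda_j,\lambda_k)\in\mathbb{Z}_{p_i}\times\mathbb{Z}_{p_j}\times\mathbb{Z}_{p_k}$. An $M$-fiber in the $p_\nu$ direction is a set $x+\{tM/p_\nu:0\le t<p_\nu\}$ (a line in the grid coordinates). -}

module Defs where

open import Data.Nat as ℕ using (ℕ; zero; suc; _∸_; _^_; _≤_; NonZero; _%_)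
open import Data.Nat.Properties using (m^n≢0; m*n≢0)
open import Data.Nat.DivMod using (m%n<n)
open import Data.Nat.Divisibility using (_∣?_)
open import Data.Nat.Primality using (Prime; prime⇒nonZero)
open import Data.Integer as ℤ using (ℤ; +_; -[1+_])
open import Data.Fin using (Fin; toℕ; fromℕ<)
open import Data.Fin.Subset using (Subset; _∈_; _∉_)
open import Data.Bool using (Bool; true; false; if_then_else_)
open import Data.List using (List; []; _∷_; _++_; [_]; map; foldr; filter; upTo; replicate)
open import Data.Vec using (toList)
import Data.Vec as Vec
open import Data.List.Relation.Unary.Any using (Any)
open import Data.List.Relation.Unary.All using (All)
open import Data.List.Relation.Unary.AllPairs using (AllPairs)
open import Data.Product using (Σ; ∃; _×_; _,_)
open import Data.Sum using (_⊎_)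
open import Relation.Nullary using (¬_)
open import Relation.Binary.PropositionalEquality using (_≡_)
open import Function.Bundles using (_⇔_)

-- Integer polynomials as coefficient lists (constant term first).

Poly : Set
Poly = List ℤ

coeff : Poly → ℕ → ℤ
coeff []       _       = + 0
coeff (a ∷ p)  zero    = a
coeff (a ∷ p)  (suc n) = coeff p n

-- equality of polynomials (ignores trailing zero coefficients)
_≃ₚ_ : Poly → Poly → Set
p ≃ₚ q = ∀ n → coeff p n ≡ coeff q n

_+ₚ_ : Poly → Poly → Poly
[]      +ₚ q       = q
(a ∷ p) +ₚ []      = a ∷ p
(a ∷ p) +ₚ (b ∷ q) = (a ℤ.+ b) ∷ (p +ₚ q)

_*ₚ_ : Poly → Poly → Poly
[]      *ₚ q = []
(a ∷ p) *ₚ q = map (a ℤ.*_) q +ₚ (+ 0 ∷ (p *ₚ q))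

oneₚ : Poly
oneₚ = [ + 1 ]

prodₚ : List Poly → Poly
prodₚ = foldr _*ₚ_ oneₚ

_∣ₚ_ : Poly → Poly → Set
P ∣ₚ A = ∃ λ Q → A ≃ₚ (P *ₚ Q)

-- the polynomial X^n - 1  (n ≥ 1)
Xⁿ-1 : ℕ → Poly
Xⁿ-1 n = -[1+ 0 ] ∷ (replicate (n ∸ 1) (+ 0) ++ [ + 1 ])

divisors : ℕ → List ℕ
divisors n = filter (λ d → d ∣? n) (map suc (upTo n))

-- Φ is the family of cyclotomic polynomials: X^n - 1 = ∏_{d ∣ n} Φ_d for all n ≥ 1.
-- (This determines Φ_n uniquely for every n ≥ 1.)
IsCyclotomicFamily : (ℕ → Poly) → Set
IsCyclotomicFamily Φ = ∀ n → 1 ≤ n → Xⁿ-1 n ≃ₚ prodₚ (map Φ (divisors n))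

Φ[_]∣_ : ℕ → Poly → Set
Φ[ M ]∣ P = Σ (ℕ → Poly) λ Φ → IsCyclotomicFamily Φ × (Φ M ∣ₚ P)

maskPoly : ∀ {M} → Subset M → Poly
maskPoly A = toList (Vec.map (λ b → if b then + 1 else + 0) A)

M3 : (pi pj pk ni nj nk : ℕ) → ℕ
M3 pi pj pk ni nj nk = pi ^ ni ℕ.* pj ^ nj ℕ.* pk ^ nk

M3-nonZero : ∀ {pi pj pk} (ni nj nk : ℕ) → Prime pi → Prime pj → Prime pk →
             NonZero (M3 pi pj pk ni nj nk)
M3-nonZero {pi} {pj} {pk} ni nj nk ppi ppj ppk =
  let instance
        _ = prime⇒nonZero ppi
        _ = prime⇒nonZero ppj
        _ = prime⇒nonZero ppk
        _ = m^n≢0 pi ni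
        _ = m^n≢0 pj nj
        _ = m^n≢0 pk nk
        _ = m*n≢0 (pi ^ ni) (pj ^ nj)
  in m*n≢0 (pi ^ ni ℕ.* pj ^ nj) (pk ^ nk)

Pt : (pi pj pk : ℕ) → Set
Pt pi pj pk = Fin pi × Fin pj × Fin pk

-- the point x0 + λ_i M/p_i + λ_j M/p_j + λ_k M/p_k of ℤ_M,
-- where mi, mj, mk stand for M/p_i, M/p_j, M/p_k
gridPt : (M : ℕ) → NonZero M → Fin M → (mi mj mk : ℕ) →
         ∀ {pi pj pk} → Pt pi pj pk → Fin M
gridPt M nz x0 mi mj mk (a , b , c) =
  fromℕ< (m%n<n (toℕ x0 ℕ.+ toℕ a ℕ.* mi ℕ.+ toℕ b ℕ.* mj ℕ.+ toℕ c ℕ.* mk) M {{nz}})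

-- M-fibers inside the grid: lines in the p_i, p_j or p_k direction
data Line (pi pj pk : ℕ) : Set where
  lineI : Fin pj → Fin pk → Line pi pj pk
  lineJ : Fin pi → Fin pk → Line pi pj pk
  lineK : Fin pi → Fin pj → Line pi pj pk

_∈L_ : ∀ {pi pj pk} → Pt pi pj pk → Line pi pj pk → Set
(a , b , c) ∈L lineI b' c' = b ≡ b' × c ≡ c'
(a , b , c) ∈L lineJ a' c' = a ≡ a' × c ≡ c'
(a , b , c) ∈L lineK a' b' = a ≡ a' × b ≡ b'

DisjointL : ∀ {pi pj pk} → Line pi pj pk → Line pi pj pk → Set
DisjointL {pi} {pj} {pk} L L' = ∀ (x : Pt pi pj pk) → ¬ (x ∈L L × x ∈L L')

IsDisjointFiberUnion : ∀ {pi pj pk} → (Pt pi pj pk → Set) → Set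
IsDisjointFiberUnion {pi} {pj} {pk} S =
  Σ (List (Line pi pj pk)) λ Ls →
    AllPairs DisjointL Ls × (∀ x → S x ⇔ Any (x ∈L_) Ls)

InDiagBoxes : ∀ {pi pj pk} → Subset pi → Subset pj → Subset pk → Pt pi pj pk → Set
InDiagBoxes I J K (a , b , c) = (a ∈ I × b ∈ J × c ∈ K) ⊎ (a ∉ I × b ∉ J × c ∉ K)

Proper : ∀ {p} → Subset p → Set
Proper I = (∃ λ x → x ∈ I) × (∃ λ x → x ∉ I)

IsDiagBoxesPlusFibers : ∀ {pi pj pk} → (Pt pi pj pk → Set) → Set
IsDiagBoxesPlusFibers {pi} {pj} {pk} S =
  Σ (Subset pi) λ I → Σ (Subset pj) λ J → Σ (Subset pk) λ K →
  Proper I × Proper J × Proper K ×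
  Σ (List (Line pi pj pk)) λ Ls →
    AllPairs DisjointL Ls ×
    All (λ L → ∀ x → x ∈L L → ¬ InDiagBoxes I J K x) Ls ×
    (∀ x → S x ⇔ (InDiagBoxes I J K x ⊎ Any (x ∈L_) Ls))

module Submission where

-- Write A(X) = Φ_M(X) Q(X) and let S be the shift (S f) n = f (n + 1) on integer sequences.
-- Pairing the coefficients of A with f equals pairing those of Q with Φ_M(S) f.  For positive
-- multiples s₁, s₂, s₃ of M/p_i, M/p_j, M/p_k every divisor of M other than M divides some sₗ,
-- so Φ_M (X^s₁ - 1)(X^s₂ - 1)(X^s₃ - 1) is a multiple of X^M - 1 and kills M-periodic f.
-- Taking for f the indicator of a residue class shows that the alternating sum of A over the
-- eight vertices of every box in the grid Λ vanishes.
--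
-- Permuting coordinates, let p_i = 2.  Then g(b, c) = A(0, b, c) - A(1, b, c) ∈ {-1, 0, 1}
-- satisfies g(b, c) + g(b′, c′) = g(b, c′) + g(b′, c).  If g is constant along one of the
-- remaining directions, A ∩ Λ is a disjoint union of fibers.  Otherwise some 2 × 2 minor of g
-- is (1 0 / 0 -1) up to order, say at rows b₊, b₋ and columns c₊, c₋, and then g(b, c) is 1,
-- -1 or 0 according as b ∈ J and c ∈ K, b ∉ J and c ∉ K, or neither, where
-- J = {b : g(b, c₋) = 0} and K = {c : g(b₋, c) = 0}.  So A ∩ Λ is ({0} × J × K) ∪
-- ({1} × Jᶜ × Kᶜ) together with the fibers in the p_i direction through the points with g = 0.

open import Defs
open import Data.Nat using (ℕ)
open import Data.Bool using (Bool)
open import Data.Nat.Primality using (Prime)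

module ShiftAction where

  open import Data.Nat as ℕ using (ℕ; zero; suc; NonZero)
  import Data.Nat.Properties as ℕ
  open import Data.Integer using (ℤ; +_; -[1+_]; _+_; _*_; -_; _-_)
  import Data.Integer.Properties as ℤ
  open import Data.Integer.Tactic.RingSolver using (solve-∀)
  open import Algebra.Properties.CommutativeSemigroup ℕ.+-commutativeSemigroup using (xy∙z≈xz∙y)
  open import Data.List using (List; []; _∷_; _++_; [_]; map; replicate)
  open import Function using (_∘_; const)
  open import Relation.Binary.PropositionalEquality
    using (_≡_; refl; sym; trans; cong; cong₂; _≗_; module ≡-Reasoning)

  pairing : Poly → (ℕ → ℤ) → ℤ
  pairing []      f = + 0
  pairing (a ∷ p) f = a * f 0 + pairing p (f ∘ suc)

  pairing-cong : ∀ p {f g : ℕ → ℤ} → f ≗ g → pairing p f ≡ pairing p g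
  pairing-cong []      f≗g = refl
  pairing-cong (a ∷ p) f≗g = cong₂ (λ x y → a * x + y) (f≗g 0) (pairing-cong p (f≗g ∘ suc))

  pairing-+ : ∀ p (f g : ℕ → ℤ) → pairing p (λ n → f n + g n) ≡ pairing p f + pairing p g
  pairing-+ []      f g = refl
  pairing-+ (a ∷ p) f g =
    trans (cong (λ u → a * (f 0 + g 0) + u) (pairing-+ p (f ∘ suc) (g ∘ suc)))
          (distrib a (f 0) (g 0) (pairing p (f ∘ suc)) (pairing p (g ∘ suc)))
    where
    distrib : ∀ a x y u v → a * (x + y) + (u + v) ≡ (a * x + u) + (a * y + v)
    distrib = solve-∀

  pairing-scale : ∀ p c (f : ℕ → ℤ) → pairing p (λ n → c * f n) ≡ c * pairing p f
  pairing-scale []      c f = sym (ℤ.*-zeroʳ c)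
  pairing-scale (a ∷ p) c f =
    trans (cong (λ u → a * (c * f 0) + u) (pairing-scale p c (f ∘ suc)))
          (factor a c (f 0) (pairing p (f ∘ suc)))
    where
    factor : ∀ a c x u → a * (c * x) + c * u ≡ c * (a * x + u)
    factor = solve-∀

  pairing-zero : ∀ p {f : ℕ → ℤ} → f ≗ const (+ 0) → pairing p f ≡ + 0
  pairing-zero p {f} f≗0 = begin
    pairing p f                       ≡⟨ pairing-cong p (λ n → trans (f≗0 n) (sym (ℤ.*-zeroˡ (+ 0)))) ⟩
    pairing p (λ _ → + 0 * + 0)       ≡⟨ pairing-scale p (+ 0) (const (+ 0)) ⟩
    + 0 * pairing p (const (+ 0))     ≡⟨ ℤ.*-zeroˡ (pairing p (const (+ 0))) ⟩
    + 0                               ∎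
    where open ≡-Reasoning

  pairing-- : ∀ p (f g : ℕ → ℤ) → pairing p (λ n → f n - g n) ≡ pairing p f - pairing p g
  pairing-- p f g = begin
    pairing p (λ n → f n - g n)                     ≡⟨ pairing-+ p f (λ n → - g n) ⟩
    pairing p f + pairing p (λ n → - g n)           ≡⟨ cong (λ u → pairing p f + u) negate ⟩
    pairing p f - pairing p g                       ∎
    where
    open ≡-Reasoning
    negate : pairing p (λ n → - g n) ≡ - pairing p g
    negate = begin
      pairing p (λ n → - g n)             ≡⟨ pairing-cong p (λ n → sym (ℤ.-1*i≡-i (g n))) ⟩
      pairing p (λ n → -[1+ 0 ] * g n)    ≡⟨ pairing-scale p -[1+ 0 ] g ⟩
      -[1+ 0 ] * pairing p g              ≡⟨ ℤ.-1*i≡-i _ ⟩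
      - pairing p g                       ∎

  pairing-+ₚ : ∀ p q (f : ℕ → ℤ) → pairing (p +ₚ q) f ≡ pairing p f + pairing q f
  pairing-+ₚ []      q       f = sym (ℤ.+-identityˡ _)
  pairing-+ₚ (a ∷ p) []      f = sym (ℤ.+-identityʳ _)
  pairing-+ₚ (a ∷ p) (b ∷ q) f =
    trans (cong (λ u → (a + b) * f 0 + u) (pairing-+ₚ p q (f ∘ suc)))
          (distrib a b (f 0) (pairing p (f ∘ suc)) (pairing q (f ∘ suc)))
    where
    distrib : ∀ a b x u v → (a + b) * x + (u + v) ≡ (a * x + u) + (b * x + v)
    distrib = solve-∀

  pairing-map-* : ∀ a q (f : ℕ → ℤ) → pairing (map (a *_) q) f ≡ a * pairing q f
  pairing-map-* a []      f = sym (ℤ.*-zeroʳ a)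
  pairing-map-* a (b ∷ q) f =
    trans (cong (λ u → a * b * f 0 + u) (pairing-map-* a q (f ∘ suc)))
          (factor a b (f 0) (pairing q (f ∘ suc)))
    where
    factor : ∀ a b x u → a * b * x + a * u ≡ a * (b * x + u)
    factor = solve-∀

  pairing-swap : ∀ p q (h : ℕ → ℕ → ℤ) →
                 pairing p (λ t → pairing q (h t)) ≡ pairing q (λ s → pairing p (λ t → h t s))
  pairing-swap []      q h = sym (pairing-zero q (λ _ → refl))
  pairing-swap (a ∷ p) q h = begin
    a * pairing q (h 0) + pairing p (λ t → pairing q (h (suc t)))
      ≡⟨ cong₂ _+_ (sym (pairing-scale q a (h 0))) (pairing-swap p q (h ∘ suc)) ⟩
    pairing q (λ s → a * h 0 s) + pairing q (λ s → pairing p (λ t → h (suc t) s))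
      ≡⟨ sym (pairing-+ q _ _) ⟩
    pairing q (λ s → a * h 0 s + pairing p (λ t → h (suc t) s))
      ∎
    where open ≡-Reasoning

  -- p acts on sequences as p(S) for the shift (S f) n = f (n + 1)
  act : Poly → (ℕ → ℤ) → ℕ → ℤ
  act p f n = pairing p (λ t → f (n ℕ.+ t))

  pairing-*ₚ : ∀ p q (f : ℕ → ℤ) → pairing (p *ₚ q) f ≡ pairing q (act p f)
  pairing-*ₚ []      q f = sym (pairing-zero q (λ _ → refl))
  pairing-*ₚ (a ∷ p) q f = begin
    pairing (map (a *_) q +ₚ (+ 0 ∷ p *ₚ q)) f
      ≡⟨ pairing-+ₚ (map (a *_) q) _ f ⟩
    pairing (map (a *_) q) f + (+ 0 * f 0 + pairing (p *ₚ q) (f ∘ suc))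
      ≡⟨ cong₂ _+_ (pairing-map-* a q f) (dropZero (f 0) _) ⟩
    a * pairing q f + pairing (p *ₚ q) (f ∘ suc)
      ≡⟨ cong₂ _+_ (sym (pairing-scale q a f)) (pairing-*ₚ p q (f ∘ suc)) ⟩
    pairing q (λ s → a * f s) + pairing q (λ s → pairing p (λ t → f (suc (s ℕ.+ t))))
      ≡⟨ sym (pairing-+ q _ _) ⟩
    pairing q (λ s → a * f s + pairing p (λ t → f (suc (s ℕ.+ t))))
      ≡⟨ pairing-cong q (λ s → cong₂ (λ x y → a * f x + y)
                                     (sym (ℕ.+-identityʳ s))
                                     (pairing-cong p (λ t → cong f (sym (ℕ.+-suc s t))))) ⟩
    pairing q (λ s → a * f (s ℕ.+ 0) + pairing p (λ t → f (s ℕ.+ suc t)))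
      ∎
    where
    open ≡-Reasoning
    dropZero : ∀ x u → + 0 * x + u ≡ u
    dropZero = solve-∀

  pairing-zeroCoeffs : ∀ p (f : ℕ → ℤ) → (∀ n → coeff p n ≡ + 0) → pairing p f ≡ + 0
  pairing-zeroCoeffs []      f _  = refl
  pairing-zeroCoeffs (a ∷ p) f p≡0 =
    trans (cong₂ (λ x y → x * f 0 + y) (p≡0 0) (pairing-zeroCoeffs p (f ∘ suc) (p≡0 ∘ suc)))
          (ℤ.*-zeroˡ (f 0))

  pairing-≃ₚ : ∀ p q (f : ℕ → ℤ) → p ≃ₚ q → pairing p f ≡ pairing q f
  pairing-≃ₚ []      q       f p≃q = sym (pairing-zeroCoeffs q f (sym ∘ p≃q))
  pairing-≃ₚ (a ∷ p) []      f p≃q = pairing-zeroCoeffs (a ∷ p) f p≃q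
  pairing-≃ₚ (a ∷ p) (b ∷ q) f p≃q =
    cong₂ (λ x y → x * f 0 + y) (p≃q 0) (pairing-≃ₚ p q (f ∘ suc) (p≃q ∘ suc))

  pairing-monomial : ∀ k (f : ℕ → ℤ) → pairing (replicate k (+ 0) ++ [ + 1 ]) f ≡ f k
  pairing-monomial zero    f = trans (ℤ.+-identityʳ _) (ℤ.*-identityˡ _)
  pairing-monomial (suc k) f =
    trans (cong (λ u → u + rest) (ℤ.*-zeroˡ (f 0)))
          (trans (ℤ.+-identityˡ rest) (pairing-monomial k (f ∘ suc)))
    where
    rest = pairing (replicate k (+ 0) ++ [ + 1 ]) (f ∘ suc)

  Δ : ℕ → (ℕ → ℤ) → ℕ → ℤ
  Δ s f n = f (n ℕ.+ s) - f n

  Δ-cong : ∀ s {f g : ℕ → ℤ} → f ≗ g → Δ s f ≗ Δ s g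
  Δ-cong s f≗g n = cong₂ _-_ (f≗g (n ℕ.+ s)) (f≗g n)

  Δs : List ℕ → (ℕ → ℤ) → ℕ → ℤ
  Δs []       f = f
  Δs (s ∷ ss) f = Δ s (Δs ss f)

  Δs-cong : ∀ ss {f g : ℕ → ℤ} → f ≗ g → Δs ss f ≗ Δs ss g
  Δs-cong []       f≗g = f≗g
  Δs-cong (s ∷ ss) f≗g = Δ-cong s (Δs-cong ss f≗g)

  Δs-shift : ∀ ss (f : ℕ → ℤ) s n → Δs ss f (n ℕ.+ s) ≡ Δs ss (λ m → f (m ℕ.+ s)) n
  Δs-shift []       f s n = refl
  Δs-shift (t ∷ ss) f s n =
    cong₂ _-_ (trans (cong (Δs ss f) (xy∙z≈xz∙y n s t)) (Δs-shift ss f s (n ℕ.+ t)))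
              (Δs-shift ss f s n)

  Periodic : ℕ → (ℕ → ℤ) → Set
  Periodic M f = ∀ n → f (n ℕ.+ M) ≡ f n

  act-cong : ∀ p {f g : ℕ → ℤ} → f ≗ g → act p f ≗ act p g
  act-cong p f≗g n = pairing-cong p (λ t → f≗g (n ℕ.+ t))

  act-comm : ∀ p q (f : ℕ → ℤ) → act p (act q f) ≗ act q (act p f)
  act-comm p q f n =
    trans (pairing-swap p q (λ t s → f (n ℕ.+ t ℕ.+ s)))
          (pairing-cong q (λ s → pairing-cong p (λ t → cong f (xy∙z≈xz∙y n t s))))

  act-*ₚ : ∀ p q (f : ℕ → ℤ) → act (p *ₚ q) f ≗ act q (act p f)
  act-*ₚ p q f n = trans (pairing-*ₚ p q _)
    (pairing-cong q (λ s → pairing-cong p (λ t → cong f (sym (ℕ.+-assoc n s t)))))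

  act-≃ₚ : ∀ p q (f : ℕ → ℤ) → p ≃ₚ q → act p f ≗ act q f
  act-≃ₚ p q f p≃q n = pairing-≃ₚ p q _ p≃q

  act-oneₚ : ∀ (f : ℕ → ℤ) → act oneₚ f ≗ f
  act-oneₚ f n = trans (ℤ.+-identityʳ _) (trans (ℤ.*-identityˡ _) (cong f (ℕ.+-identityʳ n)))

  act-Xⁿ-1 : ∀ s .{{_ : NonZero s}} (f : ℕ → ℤ) → act (Xⁿ-1 s) f ≗ Δ s f
  act-Xⁿ-1 (suc k) f n = begin
    -[1+ 0 ] * f (n ℕ.+ 0) + pairing (replicate k (+ 0) ++ [ + 1 ]) (λ t → f (n ℕ.+ suc t))
      ≡⟨ cong₂ _+_ (ℤ.-1*i≡-i (f (n ℕ.+ 0))) (pairing-monomial k (λ t → f (n ℕ.+ suc t))) ⟩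
    - f (n ℕ.+ 0) + f (n ℕ.+ suc k)
      ≡⟨ ℤ.+-comm (- f (n ℕ.+ 0)) (f (n ℕ.+ suc k)) ⟩
    f (n ℕ.+ suc k) - f (n ℕ.+ 0)
      ≡⟨ cong (λ m → f (n ℕ.+ suc k) - f m) (ℕ.+-identityʳ n) ⟩
    f (n ℕ.+ suc k) - f n
      ∎
    where open ≡-Reasoning

  act-periodic : ∀ M p {f : ℕ → ℤ} → Periodic M f → Periodic M (act p f)
  act-periodic M p {f} per n = pairing-cong p (λ t → trans (cong f (xy∙z≈xz∙y n M t)) (per (n ℕ.+ t)))

  actAll : List Poly → (ℕ → ℤ) → ℕ → ℤ
  actAll []      f = f
  actAll (p ∷ ps) f = act p (actAll ps f)

  actAll-cong : ∀ ps {f g : ℕ → ℤ} → f ≗ g → actAll ps f ≗ actAll ps g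
  actAll-cong []       f≗g = f≗g
  actAll-cong (p ∷ ps) f≗g = act-cong p (actAll-cong ps f≗g)

  actAll-act : ∀ ps p (f : ℕ → ℤ) → actAll ps (act p f) ≗ act p (actAll ps f)
  actAll-act []       p f n = refl
  actAll-act (q ∷ ps) p f n = trans (act-cong q (actAll-act ps p f) n) (act-comm q p (actAll ps f) n)

  actAll-prodₚ : ∀ ps (f : ℕ → ℤ) → act (prodₚ ps) f ≗ actAll ps f
  actAll-prodₚ []       f n = act-oneₚ f n
  actAll-prodₚ (p ∷ ps) f n = begin
    act (p *ₚ prodₚ ps) f n     ≡⟨ act-*ₚ p (prodₚ ps) f n ⟩
    act (prodₚ ps) (act p f) n  ≡⟨ actAll-prodₚ ps (act p f) n ⟩
    actAll ps (act p f) n       ≡⟨ actAll-act ps p f n ⟩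
    act p (actAll ps f) n       ∎
    where open ≡-Reasoning

  actAll-++ : ∀ ps qs (f : ℕ → ℤ) → actAll (ps ++ qs) f ≗ actAll ps (actAll qs f)
  actAll-++ []       qs f n = refl
  actAll-++ (p ∷ ps) qs f n = act-cong p (actAll-++ ps qs f) n

  actAll-periodic : ∀ M ps {f : ℕ → ℤ} → Periodic M f → Periodic M (actAll ps f)
  actAll-periodic M []       per = per
  actAll-periodic M (p ∷ ps) per = act-periodic M p (actAll-periodic M ps per)

module Annihilation where

  open ShiftAction
  open import Data.Nat as ℕ using (ℕ; zero; suc; NonZero)
  import Data.Nat.Properties as ℕ
  open import Data.Nat.Divisibility using (_∣_; _∣?_; 0∣⇒≡0; ∣⇒≤)
  open import Data.Integer using (ℤ; +_)
  import Data.Integer.Properties as ℤ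
  open import Data.List using (List; []; _∷_; map; upTo; concatMap)
  import Data.List.Properties as List
  open import Data.List.Membership.Propositional using (_∈_)
  open import Data.List.Membership.Propositional.Properties
    using (∈-filter⁺; ∈-filter⁻; ∈-map⁺; ∈-upTo⁺; ∈-++⁺ˡ; ∈-++⁺ʳ)
  open import Data.List.Relation.Binary.Subset.Propositional using (_⊆_)
  open import Data.List.Relation.Unary.Any using (Any; here; there)
  open import Data.List.Relation.Unary.All using (All; []; _∷_)
  import Data.List.Relation.Unary.All as All
  open import Data.List.Relation.Unary.AllPairs using (_∷_)
  open import Data.List.Relation.Unary.Unique.Propositional using (Unique)
  import Data.List.Relation.Unary.Unique.Propositional.Properties as Unique
  open import Data.Product using (Σ; _×_; _,_; proj₂)
  open import Data.Empty using (⊥-elim)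
  open import Function using (const)
  open import Relation.Nullary using (yes; no)
  open import Relation.Binary.PropositionalEquality
    using (_≢_; refl; sym; trans; _≗_; module ≡-Reasoning)

  divisors-unique : ∀ n → Unique (divisors n)
  divisors-unique n = Unique.filter⁺ _ (Unique.map⁺ ℕ.suc-injective (Unique.upTo⁺ n))

  ∈-divisors⇒∣ : ∀ {d n} → d ∈ divisors n → d ∣ n
  ∈-divisors⇒∣ {n = n} d∈ = proj₂ (∈-filter⁻ (_∣? n) {xs = map suc (upTo n)} d∈)

  ∣⇒∈-divisors : ∀ {d n} .{{_ : NonZero n}} → d ∣ n → d ∈ divisors n
  ∣⇒∈-divisors {zero}  {n} 0∣n = ⊥-elim (ℕ.≢-nonZero⁻¹ n (0∣⇒≡0 0∣n))
  ∣⇒∈-divisors {suc d} {n} d∣n = ∈-filter⁺ (_∣? n) (∈-map⁺ suc (∈-upTo⁺ (∣⇒≤ d∣n))) d∣n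

  module _ (F : ℕ → Poly) where

    actAll-pull : ∀ {d} ds → d ∈ ds →
      Σ (List ℕ) λ ds′ → (∀ {e} → e ∈ ds → e ≢ d → e ∈ ds′) ×
                         (∀ f → actAll (map F ds) f ≗ act (F d) (actAll (map F ds′) f))
    actAll-pull (d ∷ ds) (here refl) =
      ds , (λ { (here refl) e≢d → ⊥-elim (e≢d refl) ; (there e∈) _ → e∈ }) , (λ f n → refl)
    actAll-pull {d} (e ∷ ds) (there d∈) with actAll-pull ds d∈
    ... | ds′ , keep , pulled =
      e ∷ ds′ ,
      (λ { (here refl) _ → here refl ; (there x∈) x≢d → there (keep x∈ x≢d) }) ,
      (λ f n → trans (act-cong (F e) (pulled f) n) (act-comm (F e) (F d) (actAll (map F ds′) f) n))

    actAll-factor : ∀ ds es → Unique ds → ds ⊆ es →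
      Σ (List ℕ) λ rs → ∀ f → actAll (map F es) f ≗ actAll (map F ds) (actAll (map F rs) f)
    actAll-factor []       es _            _    = es , λ f n → refl
    actAll-factor (d ∷ ds) es (d∉ds ∷ uds) d∷ds⊆es with actAll-pull es (d∷ds⊆es (here refl))
    ... | es′ , keep , pulled with actAll-factor ds es′ uds
          (λ e∈ → keep (d∷ds⊆es (there e∈)) (λ { refl → All.lookup d∉ds e∈ refl }))
    ... | rs , factored = rs , λ f n → trans (pulled f n) (act-cong (F d) (factored f) n)

  CoversProperDivisors : ℕ → List ℕ → Set
  CoversProperDivisors M ss = ∀ {d} → d ∣ M → d ≢ M → Any (d ∣_) ss

  ∈-concatDivisors : ∀ {d} ss → All NonZero ss → Any (d ∣_) ss → d ∈ concatMap divisors ss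
  ∈-concatDivisors (s ∷ ss) (s≢0 ∷ _)    (here d∣s) = ∈-++⁺ˡ (∣⇒∈-divisors {{s≢0}} d∣s)
  ∈-concatDivisors (s ∷ ss) (_ ∷ ss≢0) (there d∣) = ∈-++⁺ʳ (divisors s) (∈-concatDivisors ss ss≢0 d∣)

  divisors-⊆ : ∀ {M ss} → All NonZero ss → CoversProperDivisors M ss →
               divisors M ⊆ M ∷ concatMap divisors ss
  divisors-⊆ {M} {ss} ss≢0 covers {d} d∈ with d ℕ.≟ M
  ... | yes refl = here refl
  ... | no d≢M   = there (∈-concatDivisors ss ss≢0 (covers (∈-divisors⇒∣ d∈) d≢M))

  module _ {Φ : ℕ → Poly} (cyclotomic : IsCyclotomicFamily Φ) where

    actAll-divisors : ∀ s .{{_ : NonZero s}} (f : ℕ → ℤ) → actAll (map Φ (divisors s)) f ≗ Δ s f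
    actAll-divisors s f n =
      trans (sym (actAll-prodₚ (map Φ (divisors s)) f n))
            (trans (sym (act-≃ₚ (Xⁿ-1 s) (prodₚ (map Φ (divisors s))) f (cyclotomic s (ℕ.>-nonZero⁻¹ s)) n))
                   (act-Xⁿ-1 s f n))

    actAll-concatDivisors : ∀ ss → All NonZero ss → (f : ℕ → ℤ) →
                            actAll (map Φ (concatMap divisors ss)) f ≗ Δs ss f
    actAll-concatDivisors []       []           f n = refl
    actAll-concatDivisors (s ∷ ss) (s≢0 ∷ ss≢0) f n
      rewrite List.map-++ Φ (divisors s) (concatMap divisors ss) =
      trans (actAll-++ (map Φ (divisors s)) _ f n)
            (trans (actAll-divisors s {{s≢0}} _ n)
                   (Δ-cong s (actAll-concatDivisors ss ss≢0 f) n))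

    Φ-annihilates-Δs : ∀ M .{{_ : NonZero M}} ss → All NonZero ss → CoversProperDivisors M ss →
                       ∀ {f} → Periodic M f → act (Φ M) (Δs ss f) ≗ const (+ 0)
    Φ-annihilates-Δs M ss ss≢0 covers {f} per n
      with actAll-factor Φ (divisors M) (M ∷ concatMap divisors ss) (divisors-unique M) (divisors-⊆ ss≢0 covers)
    ... | rs , factored = begin
      act (Φ M) (Δs ss f) n
        ≡⟨ act-cong (Φ M) (λ m → sym (actAll-concatDivisors ss ss≢0 f m)) n ⟩
      actAll (map Φ (M ∷ concatMap divisors ss)) f n
        ≡⟨ factored f n ⟩
      actAll (map Φ (divisors M)) (actAll (map Φ rs) f) n
        ≡⟨ actAll-divisors M (actAll (map Φ rs) f) n ⟩
      Δ M (actAll (map Φ rs) f) n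
        ≡⟨ ℤ.i≡j⇒i-j≡0 (actAll-periodic M (map Φ rs) per n) ⟩
      + 0
        ∎
      where open ≡-Reasoning

module ThreePrimeDivisors where

  open import Data.Nat using (ℕ; _*_; _^_; NonZero)
  import Data.Nat.Properties as ℕ
  open import Data.Nat.Divisibility using (_∣_; _∣?_; divides; ∣1⇒≡1)
  open import Data.Nat.Primality using (Prime; prime⇒irreducible)
  open import Data.Nat.Coprimality using (Coprime; coprime-divisor)
  open import Data.Sum using (_⊎_; inj₁; inj₂)
  open import Data.Product using (_,_)
  open import Data.Empty using (⊥-elim)
  open import Relation.Nullary using (¬_; yes; no)
  open import Relation.Binary.PropositionalEquality using (_≡_; _≢_; refl; sym; trans; cong; subst)

  ∣p*n⇒∣n : ∀ {p c} n → Prime p → ¬ p ∣ c → c ∣ p * n → c ∣ n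
  ∣p*n⇒∣n n pp p∤c = coprime-divisor coprime
    where
    coprime : Coprime _ _
    coprime (i∣c , i∣p) with prime⇒irreducible pp i∣p
    ... | inj₁ i≡1 = i≡1
    ... | inj₂ refl = ⊥-elim (p∤c i∣c)

  ∣p^k*n⇒∣n : ∀ {p c} k n → Prime p → ¬ p ∣ c → c ∣ p ^ k * n → c ∣ n
  ∣p^k*n⇒∣n {c = c} ℕ.zero    n pp p∤c c∣ = subst (c ∣_) (ℕ.+-identityʳ n) c∣
  ∣p^k*n⇒∣n {p} {c} (ℕ.suc k) n pp p∤c c∣ =
    ∣p^k*n⇒∣n k n pp p∤c (∣p*n⇒∣n (p ^ k * n) pp p∤c (subst (c ∣_) (ℕ.*-assoc p (p ^ k) n) c∣))

  prime-∣-nontrivialDivisor : ∀ {p q r a b e c} → Prime p → Prime q → Prime r →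
    c ∣ p ^ a * q ^ b * r ^ e → c ≢ 1 → p ∣ c ⊎ q ∣ c ⊎ r ∣ c
  prime-∣-nontrivialDivisor {p} {q} {r} {a} {b} {e} {c} pp pq pr c∣ c≢1
    with p ∣? c | q ∣? c | r ∣? c
  ... | yes p∣c | _       | _       = inj₁ p∣c
  ... | no _    | yes q∣c | _       = inj₂ (inj₁ q∣c)
  ... | no _    | no _    | yes r∣c = inj₂ (inj₂ r∣c)
  ... | no p∤c  | no q∤c  | no r∤c  =
    ⊥-elim (c≢1 (∣1⇒≡1 (∣p^k*n⇒∣n e 1 pr r∤c (∣p^k*n⇒∣n b _ pq q∤c (∣p^k*n⇒∣n a _ pp p∤c c∣′)))))
    where
    c∣′ : c ∣ p ^ a * (q ^ b * (r ^ e * 1))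
    c∣′ = subst (c ∣_) (trans (ℕ.*-assoc (p ^ a) _ _) (cong (λ x → p ^ a * (q ^ b * x)) (sym (ℕ.*-identityʳ _)))) c∣

  ∣-cofactor : ∀ {p m c d} .{{_ : NonZero p}} → p * m ≡ c * d → p ∣ c → d ∣ m
  ∣-cofactor {p} {m} {c} {d} pm≡cd (divides q refl) =
    divides q (ℕ.*-cancelˡ-≡ m (q * d) p
      (trans pm≡cd (trans (cong (_* d) (ℕ.*-comm q p)) (ℕ.*-assoc p q d))))

module Masks where

  open ShiftAction using (pairing)
  open import Data.Nat as ℕ using (ℕ; suc; _<_; s≤s; z≤n)
  open import Data.Integer using (ℤ; +_; _+_; _*_)
  import Data.Integer.Properties as ℤ
  open import Data.Bool using (Bool; if_then_else_)
  open import Data.Fin as Fin using (Fin; toℕ)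
  open import Data.Vec using (Vec; []; _∷_; lookup)
  open import Function using (_∘_)
  open import Relation.Nullary using (does)
  open import Relation.Binary.PropositionalEquality using (_≡_; refl; trans; cong; cong₂)

  boolToℤ : Bool → ℤ
  boolToℤ b = if b then + 1 else + 0

  pairing-maskPoly-zero : ∀ {n} (V : Vec Bool n) (f : ℕ → ℤ) →
                          (∀ m → m < n → f m ≡ + 0) → pairing (maskPoly V) f ≡ + 0
  pairing-maskPoly-zero []      f _    = refl
  pairing-maskPoly-zero (b ∷ V) f f≡0 =
    trans (cong₂ (λ x y → boolToℤ b * x + y) (f≡0 0 (s≤s z≤n))
                 (pairing-maskPoly-zero V (f ∘ suc) (λ m m<n → f≡0 (suc m) (s≤s m<n))))
          (trans (ℤ.+-identityʳ _) (ℤ.*-zeroʳ (boolToℤ b)))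

  pairing-maskPoly-unit : ∀ {n} (V : Vec Bool n) (i : Fin n) (f : ℕ → ℤ) →
                          (∀ m → m < n → f m ≡ boolToℤ (does (m ℕ.≟ toℕ i))) →
                          pairing (maskPoly V) f ≡ boolToℤ (lookup V i)
  pairing-maskPoly-unit (b ∷ V) Fin.zero    f f≡e =
    trans (cong₂ (λ x y → boolToℤ b * x + y) (f≡e 0 (s≤s z≤n))
                 (pairing-maskPoly-zero V (f ∘ suc) (λ m m<n → f≡e (suc m) (s≤s m<n))))
          (trans (ℤ.+-identityʳ _) (ℤ.*-identityʳ (boolToℤ b)))
  pairing-maskPoly-unit (b ∷ V) (Fin.suc i) f f≡e =
    trans (cong₂ (λ x y → boolToℤ b * x + y) (f≡e 0 (s≤s z≤n))
                 (pairing-maskPoly-unit V i (f ∘ suc) (λ m m<n → f≡e (suc m) (s≤s m<n))))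
          (trans (cong (_+ boolToℤ (lookup V i)) (ℤ.*-zeroʳ (boolToℤ b))) (ℤ.+-identityˡ _))

module ResidueBoxes where

  open ShiftAction
  open Annihilation
  open Masks
  open import Data.Nat as ℕ using (ℕ; NonZero; _%_)
  import Data.Nat.Properties as ℕ
  open import Algebra.Properties.CommutativeSemigroup ℕ.+-commutativeSemigroup using (x∙yz≈xz∙y)
  open import Data.Nat.DivMod using (m%n<n; m<n⇒m%n≡m; %-distribˡ-+; [m+n]%n≡m%n; [m+kn]%n≡m%n)
  open import Data.Integer using (ℤ; +_; _-_)
  open import Data.Fin using (fromℕ<)
  import Data.Fin.Properties as Fin
  open import Data.Fin.Subset using (Subset)
  open import Data.Vec using (lookup)
  open import Data.List using (List; []; _∷_)
  open import Data.Nat.ListAction using (sum)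
  open import Data.List.Relation.Unary.All using (All)
  open import Data.Product using (_,_)
  open import Function using (_∘_)
  open import Function.Bundles using (mk⇔)
  open import Relation.Nullary using (does)
  open import Relation.Nullary.Decidable using (does-⇔)
  open import Relation.Binary.PropositionalEquality
    using (_≡_; sym; trans; cong; cong₂; _≗_; module ≡-Reasoning)

  boxSum : (ℕ → ℤ) → ℕ → List ℕ → ℤ
  boxSum F y []       = F y
  boxSum F y (s ∷ ss) = boxSum F y ss - boxSum F (y ℕ.+ s) ss

  boxSum-cong : ∀ {F G : ℕ → ℤ} → F ≗ G → ∀ y ss → boxSum F y ss ≡ boxSum G y ss
  boxSum-cong F≗G y []       = F≗G y
  boxSum-cong F≗G y (s ∷ ss) = cong₂ _-_ (boxSum-cong F≗G y ss) (boxSum-cong F≗G (y ℕ.+ s) ss)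

  module _ (M : ℕ) .{{_ : NonZero M}} where

    δ : ℕ → ℕ → ℤ
    δ y n = boolToℤ (does (n % M ℕ.≟ y % M))

    %-+-congʳ : ∀ {a b} k → a % M ≡ b % M → (a ℕ.+ k) % M ≡ (b ℕ.+ k) % M
    %-+-congʳ {a} {b} k a≡b = begin
      (a ℕ.+ k) % M            ≡⟨ %-distribˡ-+ a k M ⟩
      (a % M ℕ.+ k % M) % M    ≡⟨ cong (λ x → (x ℕ.+ k % M) % M) a≡b ⟩
      (b % M ℕ.+ k % M) % M    ≡⟨ %-distribˡ-+ b k M ⟨
      (b ℕ.+ k) % M            ∎
      where open ≡-Reasoning

    -- adding k (M - 1) undoes the shift by k
    %-+-cancelʳ : ∀ {a b} k → (a ℕ.+ k) % M ≡ (b ℕ.+ k) % M → a % M ≡ b % M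
    %-+-cancelʳ {a} {b} k a+k≡b+k = begin
      a % M                            ≡⟨ unshift a ⟨
      (a ℕ.+ k ℕ.+ k ℕ.* ℕ.pred M) % M ≡⟨ %-+-congʳ (k ℕ.* ℕ.pred M) a+k≡b+k ⟩
      (b ℕ.+ k ℕ.+ k ℕ.* ℕ.pred M) % M ≡⟨ unshift b ⟩
      b % M                            ∎
      where
      open ≡-Reasoning
      unshift : ∀ x → (x ℕ.+ k ℕ.+ k ℕ.* ℕ.pred M) % M ≡ x % M
      unshift x = trans (cong (_% M) (trans (ℕ.+-assoc x k _)
                          (cong (x ℕ.+_) (trans (sym (ℕ.*-suc k (ℕ.pred M))) (cong (k ℕ.*_) (ℕ.suc-pred M))))))
                        ([m+kn]%n≡m%n x k M)

    δ-periodic : ∀ y → Periodic M (δ y)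
    δ-periodic y n = cong (λ r → boolToℤ (does (r ℕ.≟ y % M))) ([m+n]%n≡m%n n M)

    δ-shift : ∀ y s n → δ (y ℕ.+ s) (n ℕ.+ s) ≡ δ y n
    δ-shift y s n = cong boolToℤ (does-⇔ (mk⇔ (%-+-cancelʳ s) (%-+-congʳ s))
                                         ((n ℕ.+ s) % M ℕ.≟ (y ℕ.+ s) % M) (n % M ℕ.≟ y % M))

    pairing-Δs-δ : ∀ P ss y → pairing P (Δs ss (δ (y ℕ.+ sum ss))) ≡ boxSum (pairing P ∘ δ) y ss
    pairing-Δs-δ P []       y = cong (λ z → pairing P (δ z)) (ℕ.+-identityʳ y)
    pairing-Δs-δ P (s ∷ ss) y = begin
      pairing P (Δs (s ∷ ss) h)
        ≡⟨ pairing-- P (λ n → Δs ss h (n ℕ.+ s)) (Δs ss h) ⟩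
      pairing P (λ n → Δs ss h (n ℕ.+ s)) - pairing P (Δs ss h)
        ≡⟨ cong₂ _-_ (pairing-cong P lower) (pairing-cong P upper) ⟩
      pairing P (Δs ss (δ (y ℕ.+ sum ss))) - pairing P (Δs ss (δ (y ℕ.+ s ℕ.+ sum ss)))
        ≡⟨ cong₂ _-_ (pairing-Δs-δ P ss y) (pairing-Δs-δ P ss (y ℕ.+ s)) ⟩
      boxSum (pairing P ∘ δ) y (s ∷ ss)
        ∎
      where
      open ≡-Reasoning
      h = δ (y ℕ.+ (s ℕ.+ sum ss))
      lower : (λ n → Δs ss h (n ℕ.+ s)) ≗ Δs ss (δ (y ℕ.+ sum ss))
      lower n = trans (Δs-shift ss h s n) (Δs-cong ss (λ m →
        trans (cong (λ z → δ z (m ℕ.+ s)) (x∙yz≈xz∙y y s (sum ss))) (δ-shift (y ℕ.+ sum ss) s m)) n)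
      upper : Δs ss h ≗ Δs ss (δ (y ℕ.+ s ℕ.+ sum ss))
      upper = Δs-cong ss (λ m → cong (λ z → δ z m) (sym (ℕ.+-assoc y s (sum ss))))

    maskAt : Subset M → ℕ → ℤ
    maskAt A y = boolToℤ (lookup A (fromℕ< (m%n<n y M)))

    pairing-mask-δ : ∀ (A : Subset M) y → pairing (maskPoly A) (δ y) ≡ maskAt A y
    pairing-mask-δ A y = pairing-maskPoly-unit A _ (δ y) (λ m m<M →
      cong₂ (λ r r′ → boolToℤ (does (r ℕ.≟ r′))) (m<n⇒m%n≡m m<M) (sym (Fin.toℕ-fromℕ< (m%n<n y M))))

    Φ∣mask⇒boxSum≡0 : ∀ (A : Subset M) → Φ[ M ]∣ maskPoly A →
                      ∀ ss → All NonZero ss → CoversProperDivisors M ss →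
                      ∀ y → boxSum (maskAt A) y ss ≡ + 0
    Φ∣mask⇒boxSum≡0 A (Φ , cyclotomic , Q , A≃ΦQ) ss ss≢0 covers y = begin
      boxSum (maskAt A) y ss                  ≡⟨ boxSum-cong (λ z → sym (pairing-mask-δ A z)) y ss ⟩
      boxSum (pairing (maskPoly A) ∘ δ) y ss  ≡⟨ pairing-Δs-δ (maskPoly A) ss y ⟨
      pairing (maskPoly A) h                  ≡⟨ pairing-≃ₚ (maskPoly A) (Φ M *ₚ Q) h A≃ΦQ ⟩
      pairing (Φ M *ₚ Q) h                    ≡⟨ pairing-*ₚ (Φ M) Q h ⟩
      pairing Q (act (Φ M) h)                 ≡⟨ pairing-zero Q (Φ-annihilates-Δs cyclotomic M ss ss≢0 covers
                                                                   (δ-periodic (y ℕ.+ sum ss))) ⟩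
      + 0                                     ∎
      where
      open ≡-Reasoning
      h = Δs ss (δ (y ℕ.+ sum ss))

module Trits where

  open import Data.Integer as ℤ using (ℤ; +_; -[1+_]; _+_; _-_)
  open import Data.Bool using (Bool; true; false)
  open import Data.Product using (_×_; _,_)
  open import Data.Sum using (_⊎_)
  open import Relation.Nullary using (yes; no; Dec)
  open import Relation.Nullary.Decidable using (from-yes; _×-dec_; _⊎-dec_; _→-dec_; ¬?)
  open import Relation.Unary using (Pred; Decidable)
  open import Level using (0ℓ)
  open import Relation.Binary.PropositionalEquality using (_≡_; _≢_; refl)
  open Masks using (boolToℤ)

  data Trit : Set where
    ⊕ ⊙ ⊖ : Trit

  ⟦_⟧ : Trit → ℤ
  ⟦ ⊕ ⟧ = + 1
  ⟦ ⊙ ⟧ = + 0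
  ⟦ ⊖ ⟧ = -[1+ 0 ]

  _≟_ : (s t : Trit) → Dec (s ≡ t)
  ⊕ ≟ ⊕ = yes refl
  ⊕ ≟ ⊙ = no λ ()
  ⊕ ≟ ⊖ = no λ ()
  ⊙ ≟ ⊕ = no λ ()
  ⊙ ≟ ⊙ = yes refl
  ⊙ ≟ ⊖ = no λ ()
  ⊖ ≟ ⊕ = no λ ()
  ⊖ ≟ ⊙ = no λ ()
  ⊖ ≟ ⊖ = yes refl

  all? : ∀ {P : Pred Trit 0ℓ} → Decidable P → Dec (∀ t → P t)
  all? P? with P? ⊕ | P? ⊙ | P? ⊖
  ... | yes p⊕ | yes p⊙ | yes p⊖ = yes λ { ⊕ → p⊕ ; ⊙ → p⊙ ; ⊖ → p⊖ }
  ... | no ¬p  | _      | _      = no λ p → ¬p (p ⊕)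
  ... | yes _  | no ¬p  | _      = no λ p → ¬p (p ⊙)
  ... | yes _  | yes _  | no ¬p  = no λ p → ¬p (p ⊖)

  OppositeCorners : Trit → Trit → Trit → Trit → Set
  OppositeCorners s₁₁ s₁₂ s₂₁ s₂₂ =
    (s₁₁ ≡ ⊕ × s₂₂ ≡ ⊖ × s₁₂ ≡ ⊙ × s₂₁ ≡ ⊙) ⊎ (s₁₁ ≡ ⊖ × s₂₂ ≡ ⊕ × s₁₂ ≡ ⊙ × s₂₁ ≡ ⊙) ⊎
    (s₁₂ ≡ ⊕ × s₂₁ ≡ ⊖ × s₁₁ ≡ ⊙ × s₂₂ ≡ ⊙) ⊎ (s₁₂ ≡ ⊖ × s₂₁ ≡ ⊕ × s₁₁ ≡ ⊙ × s₂₂ ≡ ⊙)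

  oppositeCorners : ∀ s₁₁ s₁₂ s₂₁ s₂₂ → ⟦ s₁₁ ⟧ + ⟦ s₂₂ ⟧ ≡ ⟦ s₁₂ ⟧ + ⟦ s₂₁ ⟧ →
                    s₁₁ ≢ s₁₂ → s₁₁ ≢ s₂₁ → OppositeCorners s₁₁ s₁₂ s₂₁ s₂₂
  oppositeCorners = from-yes (all? λ s₁₁ → all? λ s₁₂ → all? λ s₂₁ → all? λ s₂₂ →
    (⟦ s₁₁ ⟧ + ⟦ s₂₂ ⟧ ℤ.≟ ⟦ s₁₂ ⟧ + ⟦ s₂₁ ⟧) →-dec ¬? (s₁₁ ≟ s₁₂) →-dec ¬? (s₁₁ ≟ s₂₁) →-dec
    ((s₁₁ ≟ ⊕ ×-dec s₂₂ ≟ ⊖ ×-dec s₁₂ ≟ ⊙ ×-dec s₂₁ ≟ ⊙) ⊎-dec (s₁₁ ≟ ⊖ ×-dec s₂₂ ≟ ⊕ ×-dec s₁₂ ≟ ⊙ ×-dec s₂₁ ≟ ⊙) ⊎-dec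
     (s₁₂ ≟ ⊕ ×-dec s₂₁ ≟ ⊖ ×-dec s₁₁ ≟ ⊙ ×-dec s₂₂ ≟ ⊙) ⊎-dec (s₁₂ ≟ ⊖ ×-dec s₂₁ ≟ ⊕ ×-dec s₁₁ ≟ ⊙ ×-dec s₂₂ ≟ ⊙)))

  difference : Bool → Bool → Trit
  difference true  false = ⊕
  difference false true  = ⊖
  difference true  true  = ⊙
  difference false false = ⊙

  ⟦difference⟧ : ∀ x y → ⟦ difference x y ⟧ ≡ boolToℤ x - boolToℤ y
  ⟦difference⟧ true  true  = refl
  ⟦difference⟧ true  false = refl
  ⟦difference⟧ false true  = refl
  ⟦difference⟧ false false = refl

  difference≡⊕ : ∀ {x y} → difference x y ≡ ⊕ → x ≡ true × y ≡ false
  difference≡⊕ {true}  {false} _ = refl , refl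
  difference≡⊕ {true}  {true}  ()
  difference≡⊕ {false} {true}  ()
  difference≡⊕ {false} {false} ()

  difference≡⊖ : ∀ {x y} → difference x y ≡ ⊖ → x ≡ false × y ≡ true
  difference≡⊖ {false} {true}  _ = refl , refl
  difference≡⊖ {true}  {false} ()
  difference≡⊖ {true}  {true}  ()
  difference≡⊖ {false} {false} ()

  difference≡⊙ : ∀ {x y} → difference x y ≡ ⊙ → x ≡ y
  difference≡⊙ {true}  {true}  _ = refl
  difference≡⊙ {false} {false} _ = refl
  difference≡⊙ {true}  {false} ()
  difference≡⊙ {false} {true}  ()

  ⟦⟧-injective : ∀ {s t} → ⟦ s ⟧ ≡ ⟦ t ⟧ → s ≡ t
  ⟦⟧-injective {⊕} {⊕} _ = refl
  ⟦⟧-injective {⊙} {⊙} _ = refl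
  ⟦⟧-injective {⊖} {⊖} _ = refl
  ⟦⟧-injective {⊕} {⊙} ()
  ⟦⟧-injective {⊕} {⊖} ()
  ⟦⟧-injective {⊙} {⊕} ()
  ⟦⟧-injective {⊙} {⊖} ()
  ⟦⟧-injective {⊖} {⊕} ()
  ⟦⟧-injective {⊖} {⊙} ()

  isZero : Trit → Bool
  isZero ⊙ = true
  isZero ⊕ = false
  isZero ⊖ = false

  diagonal : Bool → Bool → Trit
  diagonal true  true  = ⊕
  diagonal false false = ⊖
  diagonal true  false = ⊙
  diagonal false true  = ⊙

  nonpositive : ∀ s t → ⟦ s ⟧ + ⟦ ⊕ ⟧ ≡ ⟦ t ⟧ + ⟦ ⊙ ⟧ → s ≢ ⊕
  nonpositive = from-yes (all? λ s → all? λ t → (⟦ s ⟧ + ⟦ ⊕ ⟧ ℤ.≟ ⟦ t ⟧ + ⟦ ⊙ ⟧) →-dec ¬? (s ≟ ⊕))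

  diagonal-sum : ∀ s u v → ⟦ s ⟧ + ⟦ ⊖ ⟧ ≡ ⟦ u ⟧ + ⟦ v ⟧ → u ≢ ⊕ → v ≢ ⊕ →
                 s ≡ diagonal (isZero u) (isZero v)
  diagonal-sum = from-yes (all? λ s → all? λ u → all? λ v →
    (⟦ s ⟧ + ⟦ ⊖ ⟧ ℤ.≟ ⟦ u ⟧ + ⟦ v ⟧) →-dec ¬? (u ≟ ⊕) →-dec ¬? (v ≟ ⊕) →-dec
    (s ≟ diagonal (isZero u) (isZero v)))

module FiberSets where

  open import Data.Nat using (ℕ)
  open import Data.Fin using (Fin)
  open import Data.Fin.Subset using (Subset)
  open import Data.Bool using (Bool; true)
  open import Data.List using (List; map; filter; cartesianProduct; allFin)
  open import Data.List.Membership.Propositional using (find; lose)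
  open import Data.List.Membership.Propositional.Properties
    using (∈-filter⁻; ∈-filter⁺; ∈-cartesianProduct⁺; ∈-allFin)
  open import Data.List.Relation.Unary.Any as Any using (Any)
  import Data.List.Relation.Unary.Any.Properties as Any
  open import Data.List.Relation.Unary.All as All using (All)
  import Data.List.Relation.Unary.All.Properties as All
  open import Data.List.Relation.Unary.AllPairs as AllPairs using (AllPairs)
  import Data.List.Relation.Unary.AllPairs.Properties as AllPairs
  import Data.List.Relation.Unary.Unique.Propositional.Properties as Unique
  open import Data.Product using (∃; _×_; _,_; proj₁; proj₂)
  open import Data.Product.Properties using (×-≡,≡→≡)
  open import Data.Sum using (_⊎_; inj₁; inj₂)
  open import Function using (_∘_)
  open import Function.Bundles using (_⇔_; mk⇔; Equivalence)
  open import Relation.Unary using (Pred; Decidable)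
  open import Relation.Binary.PropositionalEquality using (_≡_; _≢_; sym; trans; subst)
  open import Level using (0ℓ)

  module _ {p q r m n : ℕ} (f : Fin m × Fin n → Line p q r)
           {P : Pred (Fin m × Fin n) 0ℓ} (P? : Decidable P) where

    linesWhere : List (Line p q r)
    linesWhere = map f (filter P? (cartesianProduct (allFin m) (allFin n)))

    linesWhere-disjoint : (∀ {u v} → u ≢ v → DisjointL (f u) (f v)) → AllPairs DisjointL linesWhere
    linesWhere-disjoint disjoint = AllPairs.map⁺ (AllPairs.filter⁺ P? (AllPairs.map disjoint
      (Unique.cartesianProduct⁺ (Unique.allFin⁺ m) (Unique.allFin⁺ n))))

    ∈-linesWhere⁻ : ∀ {x} → Any (x ∈L_) linesWhere → ∃ λ u → P u × x ∈L f u
    ∈-linesWhere⁻ x∈ with find (Any.map⁻ x∈)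
    ... | u , u∈ , x∈fu = u , proj₂ (∈-filter⁻ P? {xs = cartesianProduct (allFin m) (allFin n)} u∈) , x∈fu

    ∈-linesWhere⁺ : ∀ {x} u → P u → x ∈L f u → Any (x ∈L_) linesWhere
    ∈-linesWhere⁺ (i , j) Pu x∈fu =
      Any.map⁺ (lose (∈-filter⁺ P? (∈-cartesianProduct⁺ (∈-allFin i) (∈-allFin j)) Pu) x∈fu)

    All-linesWhere : ∀ {Q : Line p q r → Set} → (∀ {u} → P u → Q (f u)) → All Q linesWhere
    All-linesWhere Qf = All.map⁺ (All.map Qf (All.all-filter P? (cartesianProduct (allFin m) (allFin n))))

  lineI-disjoint : ∀ {p q r} {u v : Fin q × Fin r} → u ≢ v →
                   DisjointL {p} (lineI (proj₁ u) (proj₂ u)) (lineI (proj₁ v) (proj₂ v))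
  lineI-disjoint u≢v _ ((b≡ , c≡) , (b≡′ , c≡′)) = u≢v (×-≡,≡→≡ (trans (sym b≡) b≡′ , trans (sym c≡) c≡′))

  lineK-disjoint : ∀ {p q r} {u v : Fin p × Fin q} → u ≢ v →
                   DisjointL {pk = r} (lineK (proj₁ u) (proj₂ u)) (lineK (proj₁ v) (proj₂ v))
  lineK-disjoint u≢v _ ((a≡ , b≡) , (a≡′ , b≡′)) = u≢v (×-≡,≡→≡ (trans (sym a≡) a≡′ , trans (sym b≡) b≡′))

  Support : ∀ {A : Set} → (A → Bool) → A → Set
  Support σ x = σ x ≡ true

  module _ {p q r} {S T : Pt p q r → Set} (S⇔T : ∀ x → S x ⇔ T x) where

    private
      ⇔-trans : ∀ {x} {U : Set} → S x ⇔ U → T x ⇔ U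
      ⇔-trans {x} S⇔U = mk⇔ (Equivalence.to S⇔U ∘ Equivalence.from (S⇔T x))
                            (Equivalence.to (S⇔T x) ∘ Equivalence.from S⇔U)

    fiberUnion-cong : IsDisjointFiberUnion S → IsDisjointFiberUnion T
    fiberUnion-cong (Ls , disjoint , S⇔) = Ls , disjoint , ⇔-trans ∘ S⇔

    diagBoxes-cong : IsDiagBoxesPlusFibers S → IsDiagBoxesPlusFibers T
    diagBoxes-cong (I , J , K , pI , pJ , pK , Ls , disjoint , outside , S⇔) =
      I , J , K , pI , pJ , pK , Ls , disjoint , outside , ⇔-trans ∘ S⇔

  Boxes : (p q r : ℕ) → Set
  Boxes p q r = Subset p × Subset q × Subset r

  InBoxes : ∀ {p q r} → Boxes p q r → Pt p q r → Set
  InBoxes (I , J , K) = InDiagBoxes I J K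

  ProperBoxes : ∀ {p q r} → Boxes p q r → Set
  ProperBoxes (I , J , K) = Proper I × Proper J × Proper K

  record Relabelling (p q r p′ q′ r′ : ℕ) : Set where
    field
      point         : Pt p′ q′ r′ → Pt p q r
      unpoint       : Pt p q r → Pt p′ q′ r′
      point∘unpoint : ∀ x → point (unpoint x) ≡ x
      line          : Line p′ q′ r′ → Line p q r
      ∈-line        : ∀ {x L} → x ∈L L → point x ∈L line L
      ∈-line⁻       : ∀ {x L} → point x ∈L line L → x ∈L L
      boxes         : Boxes p′ q′ r′ → Boxes p q r
      boxes-proper  : ∀ B → ProperBoxes B → ProperBoxes (boxes B)
      ∈-boxes       : ∀ B {x} → InBoxes B x → InBoxes (boxes B) (point x)
      ∈-boxes⁻      : ∀ B {x} → InBoxes (boxes B) (point x) → InBoxes B x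

  module _ {p q r p′ q′ r′} (ρ : Relabelling p q r p′ q′ r′) {S : Pt p q r → Set} where
    open Relabelling ρ

    private
      along : ∀ (A : Pt p q r → Set) {y} → A (point (unpoint y)) → A y
      along A {y} = subst A (point∘unpoint y)

      back : ∀ (A : Pt p q r → Set) {y} → A y → A (point (unpoint y))
      back A {y} = subst A (sym (point∘unpoint y))

      ∈-line⁻′ : ∀ {y L} → y ∈L line L → unpoint y ∈L L
      ∈-line⁻′ {L = L} y∈ = ∈-line⁻ (back (_∈L line L) y∈)

      lines-disjoint : ∀ {Ls} → AllPairs DisjointL Ls → AllPairs DisjointL (map line Ls)
      lines-disjoint = AllPairs.map⁺ ∘ AllPairs.map (λ disj y (y∈L , y∈L′) → disj (unpoint y) (∈-line⁻′ y∈L , ∈-line⁻′ y∈L′))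

      ∈-lines : ∀ {Ls y} → Any (unpoint y ∈L_) Ls → Any (y ∈L_) (map line Ls)
      ∈-lines {y = y} = Any.map⁺ ∘ Any.map (λ {L} → along (_∈L line L) ∘ ∈-line)

      ∈-lines⁻ : ∀ {Ls y} → Any (y ∈L_) (map line Ls) → Any (unpoint y ∈L_) Ls
      ∈-lines⁻ = Any.map ∈-line⁻′ ∘ Any.map⁻

    fiberUnion-relabel : IsDisjointFiberUnion (S ∘ point) → IsDisjointFiberUnion S
    fiberUnion-relabel (Ls , disjoint , S⇔) =
      map line Ls , lines-disjoint disjoint ,
      λ y → mk⇔ (λ Sy → ∈-lines (Equivalence.to (S⇔ (unpoint y)) (back S Sy)))
                (λ y∈ → along S (Equivalence.from (S⇔ (unpoint y)) (∈-lines⁻ y∈)))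

    diagBoxes-relabel : IsDiagBoxesPlusFibers (S ∘ point) → IsDiagBoxesPlusFibers S
    diagBoxes-relabel (I , J , K , properI , properJ , properK , Ls , disjoint , outside , S⇔)
      with boxes (I , J , K) in eq | boxes-proper (I , J , K) (properI , properJ , properK)
    ... | I′ , J′ , K′ | properI′ , properJ′ , properK′ =
      I′ , J′ , K′ , properI′ , properJ′ , properK′ , map line Ls , lines-disjoint disjoint ,
      All.map⁺ (All.map (λ off y y∈ y∈B → off (unpoint y) (∈-line⁻′ y∈) (∈-boxes⁻′ (back (InDiagBoxes I′ J′ K′) y∈B))) outside) ,
      λ y → mk⇔ (λ Sy → forth (Equivalence.to (S⇔ (unpoint y)) (back S Sy)))
                (λ y∈ → along S (Equivalence.from (S⇔ (unpoint y)) (backwards y∈)))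
      where
      ∈-boxes′ : ∀ {x} → InDiagBoxes I J K x → InDiagBoxes I′ J′ K′ (point x)
      ∈-boxes′ = subst (λ B → InBoxes B _) eq ∘ ∈-boxes (I , J , K)
      ∈-boxes⁻′ : ∀ {x} → InDiagBoxes I′ J′ K′ (point x) → InDiagBoxes I J K x
      ∈-boxes⁻′ = ∈-boxes⁻ (I , J , K) ∘ subst (λ B → InBoxes B _) (sym eq)
      forth : ∀ {y} → InDiagBoxes I J K (unpoint y) ⊎ Any (unpoint y ∈L_) Ls →
              InDiagBoxes I′ J′ K′ y ⊎ Any (y ∈L_) (map line Ls)
      forth (inj₁ y∈B) = inj₁ (along (InDiagBoxes I′ J′ K′) (∈-boxes′ y∈B))
      forth (inj₂ y∈)  = inj₂ (∈-lines y∈)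
      backwards : ∀ {y} → InDiagBoxes I′ J′ K′ y ⊎ Any (y ∈L_) (map line Ls) →
                  InDiagBoxes I J K (unpoint y) ⊎ Any (unpoint y ∈L_) Ls
      backwards (inj₁ y∈B) = inj₁ (∈-boxes⁻′ (back (InDiagBoxes I′ J′ K′) y∈B))
      backwards (inj₂ y∈)  = inj₂ (∈-lines⁻ y∈)

module CoordinateSwaps where

  open FiberSets
  open import Data.Product using (_,_)
  import Data.Sum as Sum
  open import Relation.Binary.PropositionalEquality using (refl)

  swap₁₂ : ∀ {p q r} → Relabelling p q r q p r
  swap₁₂ = record
    { point         = λ (b , a , c) → a , b , c
    ; unpoint       = λ (a , b , c) → b , a , c
    ; point∘unpoint = λ _ → refl
    ; line          = λ { (lineI a c) → lineJ a c ; (lineJ b c) → lineI b c ; (lineK b a) → lineK a b }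
    ; ∈-line        = λ { {L = lineI _ _} x∈ → x∈ ; {L = lineJ _ _} x∈ → x∈
                        ; {L = lineK _ _} (b≡ , a≡) → a≡ , b≡ }
    ; ∈-line⁻       = λ { {L = lineI _ _} x∈ → x∈ ; {L = lineJ _ _} x∈ → x∈
                        ; {L = lineK _ _} (a≡ , b≡) → b≡ , a≡ }
    ; boxes         = λ (J , I , K) → I , J , K
    ; boxes-proper  = λ _ (pJ , pI , pK) → pI , pJ , pK
    ; ∈-boxes       = λ _ → Sum.map (λ (b , a , c) → a , b , c) (λ (b , a , c) → a , b , c)
    ; ∈-boxes⁻      = λ _ → Sum.map (λ (a , b , c) → b , a , c) (λ (a , b , c) → b , a , c)
    }

  swap₁₃ : ∀ {p q r} → Relabelling p q r r q p
  swap₁₃ = record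
    { point         = λ (c , b , a) → a , b , c
    ; unpoint       = λ (a , b , c) → c , b , a
    ; point∘unpoint = λ _ → refl
    ; line          = λ { (lineI b a) → lineK a b ; (lineJ c a) → lineJ a c ; (lineK c b) → lineI b c }
    ; ∈-line        = λ { {L = lineI _ _} (b≡ , a≡) → a≡ , b≡ ; {L = lineJ _ _} (c≡ , a≡) → a≡ , c≡
                        ; {L = lineK _ _} (c≡ , b≡) → b≡ , c≡ }
    ; ∈-line⁻       = λ { {L = lineI _ _} (a≡ , b≡) → b≡ , a≡ ; {L = lineJ _ _} (a≡ , c≡) → c≡ , a≡
                        ; {L = lineK _ _} (b≡ , c≡) → c≡ , b≡ }
    ; boxes         = λ (K , J , I) → I , J , K
    ; boxes-proper  = λ _ (pK , pJ , pI) → pI , pJ , pK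
    ; ∈-boxes       = λ _ → Sum.map (λ (c , b , a) → a , b , c) (λ (c , b , a) → a , b , c)
    ; ∈-boxes⁻      = λ _ → Sum.map (λ (a , b , c) → c , b , a) (λ (a , b , c) → c , b , a)
    }

  swap₂₃ : ∀ {p q r} → Relabelling p q r p r q
  swap₂₃ = record
    { point         = λ (a , c , b) → a , b , c
    ; unpoint       = λ (a , b , c) → a , c , b
    ; point∘unpoint = λ _ → refl
    ; line          = λ { (lineI c b) → lineI b c ; (lineJ a b) → lineK a b ; (lineK a c) → lineJ a c }
    ; ∈-line        = λ { {L = lineI _ _} (c≡ , b≡) → b≡ , c≡ ; {L = lineJ _ _} x∈ → x∈
                        ; {L = lineK _ _} x∈ → x∈ }
    ; ∈-line⁻       = λ { {L = lineI _ _} (b≡ , c≡) → c≡ , b≡ ; {L = lineJ _ _} x∈ → x∈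
                        ; {L = lineK _ _} x∈ → x∈ }
    ; boxes         = λ (I , K , J) → I , J , K
    ; boxes-proper  = λ _ (pI , pK , pJ) → pI , pJ , pK
    ; ∈-boxes       = λ _ → Sum.map (λ (a , c , b) → a , b , c) (λ (a , c , b) → a , b , c)
    ; ∈-boxes⁻      = λ _ → Sum.map (λ (a , b , c) → a , c , b) (λ (a , b , c) → a , c , b)
    }

module CuboidSums where

  open FiberSets
  open CoordinateSwaps
  open Masks using (boolToℤ)
  open import Data.Integer using (ℤ; +_; _-_)
  open import Data.Integer.Tactic.RingSolver using (solve-∀)
  open import Data.Bool using (Bool)
  open import Data.Fin using (Fin; _<_)
  open import Data.Product using (_,_)
  open import Function using (_∘_)
  open import Relation.Binary.PropositionalEquality using (_≡_; trans)

  weight : ∀ {p q r} → (Pt p q r → Bool) → Fin p → Fin q → Fin r → ℤ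
  weight σ a b c = boolToℤ (σ (a , b , c))

  cuboidSum : ∀ {p q r} → (Pt p q r → Bool) → Fin p → Fin p → Fin q → Fin q → Fin r → Fin r → ℤ
  cuboidSum σ a a′ b b′ c c′ =
    ((weight σ a b c  - weight σ a b c′)  - (weight σ a b′ c  - weight σ a b′ c′)) -
    ((weight σ a′ b c - weight σ a′ b c′) - (weight σ a′ b′ c - weight σ a′ b′ c′))

  CuboidSumsVanish : ∀ {p q r} → (Pt p q r → Bool) → Set
  CuboidSumsVanish σ = ∀ {a a′ b b′ c c′} → a < a′ → b < b′ → c < c′ → cuboidSum σ a a′ b b′ c c′ ≡ + 0

  module _ {p q r} (σ : Pt p q r → Bool) (vanish : CuboidSumsVanish σ) where

    private
      v = weight σ

    cuboidSums-swap₁₂ : CuboidSumsVanish (σ ∘ Relabelling.point swap₁₂)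
    cuboidSums-swap₁₂ {b} {b′} {a} {a′} {c} {c′} b<b′ a<a′ c<c′ = trans
      (exchange (v a b c) (v a b c′) (v a b′ c) (v a b′ c′) (v a′ b c) (v a′ b c′) (v a′ b′ c) (v a′ b′ c′))
      (vanish a<a′ b<b′ c<c′)
      where
      exchange : ∀ x₀₀₀ x₀₀₁ x₀₁₀ x₀₁₁ x₁₀₀ x₁₀₁ x₁₁₀ x₁₁₁ →
        ((x₀₀₀ - x₀₀₁) - (x₁₀₀ - x₁₀₁)) - ((x₀₁₀ - x₀₁₁) - (x₁₁₀ - x₁₁₁)) ≡
        ((x₀₀₀ - x₀₀₁) - (x₀₁₀ - x₀₁₁)) - ((x₁₀₀ - x₁₀₁) - (x₁₁₀ - x₁₁₁))
      exchange = solve-∀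

    cuboidSums-swap₁₃ : CuboidSumsVanish (σ ∘ Relabelling.point swap₁₃)
    cuboidSums-swap₁₃ {c} {c′} {b} {b′} {a} {a′} c<c′ b<b′ a<a′ = trans
      (exchange (v a b c) (v a b c′) (v a b′ c) (v a b′ c′) (v a′ b c) (v a′ b c′) (v a′ b′ c) (v a′ b′ c′))
      (vanish a<a′ b<b′ c<c′)
      where
      exchange : ∀ x₀₀₀ x₀₀₁ x₀₁₀ x₀₁₁ x₁₀₀ x₁₀₁ x₁₁₀ x₁₁₁ →
        ((x₀₀₀ - x₁₀₀) - (x₀₁₀ - x₁₁₀)) - ((x₀₀₁ - x₁₀₁) - (x₀₁₁ - x₁₁₁)) ≡
        ((x₀₀₀ - x₀₀₁) - (x₀₁₀ - x₀₁₁)) - ((x₁₀₀ - x₁₀₁) - (x₁₁₀ - x₁₁₁))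
      exchange = solve-∀

module TwoLayers {q r : ℕ} (σ : Pt 2 q r → Bool) where

  open FiberSets
  open CuboidSums
  open Trits
  open import Data.Nat using (z<s)
  open import Data.Integer as ℤ using (ℤ; +_; _+_; _-_)
  import Data.Integer.Properties as ℤ
  open import Data.Integer.Tactic.RingSolver using (solve-∀)
  open import Algebra.Properties.AbelianGroup ℤ.+-0-abelianGroup using (∙-cancelʳ)
  open import Data.Bool as Bool using (Bool; true; false)
  open import Data.Fin as Fin using (Fin; zero; suc; _<_)
  import Data.Fin.Properties as Fin
  open import Data.Fin.Subset using (Subset; _∈_; _∉_; ⁅_⁆)
  open import Data.Fin.Subset.Properties using (x∈⁅x⁆; x≢y⇒x∉⁅y⁆)
  open import Data.Vec using (tabulate)
  import Data.Vec.Properties as Vec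
  open import Data.List using (List; _++_)
  open import Data.List.Relation.Unary.Any using (Any)
  import Data.List.Relation.Unary.Any.Properties as Any
  open import Data.List.Relation.Unary.All using (All)
  open import Data.List.Relation.Unary.AllPairs using (AllPairs)
  import Data.List.Relation.Unary.AllPairs.Properties as AllPairs
  open import Data.Product using (∃; _×_; _,_; proj₁; proj₂)
  open import Data.Sum using (_⊎_; inj₁; inj₂)
  open import Data.Empty using (⊥-elim)
  open import Function.Bundles using (mk⇔)
  open import Relation.Nullary using (¬_; Dec)
  open import Relation.Nullary.Decidable using (_×-dec_)
  open import Relation.Binary.Definitions using (tri<; tri≈; tri>)
  open import Relation.Binary.PropositionalEquality
    using (_≡_; _≢_; refl; sym; trans; cong; cong₂; subst; subst₂; module ≡-Reasoning)

  ¬∀³⇒∃¬ : ∀ {l m n} {R : Fin l → Fin m → Fin n → Set} → (∀ x y z → Dec (R x y z)) →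
           ¬ (∀ x y z → R x y z) → ∃ λ x → ∃ λ y → ∃ λ z → ¬ R x y z
  ¬∀³⇒∃¬ {l} {m} {n} {R} R? ¬∀R
    with x , ¬∀Rx ← Fin.¬∀⟶∃¬ l _ (λ x → Fin.all? λ y → Fin.all? (R? x y)) ¬∀R
    with y , ¬∀Rxy ← Fin.¬∀⟶∃¬ m _ (λ y → Fin.all? (R? x y)) ¬∀Rx
    with z , ¬Rxyz ← Fin.¬∀⟶∃¬ n _ (R? x y) ¬∀Rxy
    = x , y , z , ¬Rxyz

  true≢false : true ≢ false
  true≢false ()

  flip : Fin 2 → Fin 2
  flip zero       = suc zero
  flip (suc zero) = zero

  gap : Fin q → Fin r → Trit
  gap b c = difference (σ (zero , b , c)) (σ (suc zero , b , c))

  Both : Fin q × Fin r → Set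
  Both (b , c) = σ (zero , b , c) ≡ true × σ (suc zero , b , c) ≡ true

  both? : ∀ u → Dec (Both u)
  both? (b , c) = σ (zero , b , c) Bool.≟ true ×-dec σ (suc zero , b , c) Bool.≟ true

  pillars : List (Line 2 q r)
  pillars = linesWhere (λ (b , c) → lineI b c) both?

  pillars-disjoint : AllPairs DisjointL pillars
  pillars-disjoint = linesWhere-disjoint _ both? lineI-disjoint

  both⇒σ : ∀ a {b c} → Both (b , c) → σ (a , b , c) ≡ true
  both⇒σ zero       (σ₀ , _) = σ₀
  both⇒σ (suc zero) (_ , σ₁) = σ₁

  σ∧σ⇒both : ∀ a {b c} → σ (a , b , c) ≡ true → σ (flip a , b , c) ≡ true → Both (b , c)
  σ∧σ⇒both zero       σa σa′ = σa , σa′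
  σ∧σ⇒both (suc zero) σa σa′ = σa′ , σa

  ∈-pillars⁻ : ∀ {a b c} → Any ((a , b , c) ∈L_) pillars → σ (a , b , c) ≡ true
  ∈-pillars⁻ {a} x∈ with ∈-linesWhere⁻ _ both? x∈
  ... | _ , both , refl , refl = both⇒σ a both

  ∈-pillars : ∀ {a b c} → Both (b , c) → Any ((a , b , c) ∈L_) pillars
  ∈-pillars both = ∈-linesWhere⁺ _ both? _ both (refl , refl)

  ConstantRows ConstantColumns : Set
  ConstantRows    = ∀ b c c′ → gap b c ≡ gap b c′
  ConstantColumns = ∀ b b′ c → gap b c ≡ gap b′ c

  module _ (rows : ConstantRows) where

    RowFull : Fin 2 × Fin q → Set
    RowFull (a , b) = ∀ c → σ (a , b , c) ≡ true × σ (flip a , b , c) ≡ false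

    rowFull? : ∀ u → Dec (RowFull u)
    rowFull? (a , b) = Fin.all? λ c → σ (a , b , c) Bool.≟ true ×-dec σ (flip a , b , c) Bool.≟ false

    rowFibers : List (Line 2 q r)
    rowFibers = linesWhere (λ (a , b) → lineK a b) rowFull?

    rowFull : ∀ a {b c} → σ (a , b , c) ≡ true → σ (flip a , b , c) ≡ false → RowFull (a , b)
    rowFull zero       {b} {c} σ₀ σ₁ c′ = difference≡⊕ (trans (rows b c′ c) (cong₂ difference σ₀ σ₁))
    rowFull (suc zero) {b} {c} σ₁ σ₀ c′ with difference≡⊖ (trans (rows b c′ c) (cong₂ difference σ₀ σ₁))
    ... | σ₀′ , σ₁′ = σ₁′ , σ₀′

    rowFibers-pillars-disjoint : All (λ L → All (DisjointL L) pillars) rowFibers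
    rowFibers-pillars-disjoint = All-linesWhere _ rowFull? λ {(a , b)} full →
      All-linesWhere _ both? λ both → λ { _ ((refl , refl) , (refl , refl)) →
        true≢false (trans (sym (both⇒σ (flip a) both)) (proj₂ (full _))) }

    constantRows⇒fiberUnion : IsDisjointFiberUnion (Support σ)
    constantRows⇒fiberUnion =
      rowFibers ++ pillars ,
      AllPairs.++⁺ (linesWhere-disjoint _ rowFull? lineK-disjoint) pillars-disjoint rowFibers-pillars-disjoint ,
      λ (a , b , c) → mk⇔ (to a) from
      where
      to : ∀ a {b c} → σ (a , b , c) ≡ true → Any ((a , b , c) ∈L_) (rowFibers ++ pillars)
      to a {b} {c} σa with σ (flip a , b , c) in σa′
      ... | true  = Any.++⁺ʳ rowFibers (∈-pillars (σ∧σ⇒both a σa σa′))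
      ... | false = Any.++⁺ˡ (∈-linesWhere⁺ _ rowFull? (a , b) (rowFull a σa σa′) (refl , refl))
      from : ∀ {a b c} → Any ((a , b , c) ∈L_) (rowFibers ++ pillars) → σ (a , b , c) ≡ true
      from {c = c} x∈ with Any.++⁻ rowFibers x∈
      ... | inj₂ x∈pillar = ∈-pillars⁻ x∈pillar
      ... | inj₁ x∈row with ∈-linesWhere⁻ _ rowFull? x∈row
      ...   | _ , full , refl , refl = proj₁ (full c)

  constantRows? : Dec ConstantRows
  constantRows? = Fin.all? λ b → Fin.all? λ c → Fin.all? λ c′ → gap b c ≟ gap b c′

  constantColumns? : Dec ConstantColumns
  constantColumns? = Fin.all? λ b → Fin.all? λ b′ → Fin.all? λ c → gap b c ≟ gap b′ c

  module _ (vanish : CuboidSumsVanish σ) where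

    private
      g : Fin q → Fin r → ℤ
      g b c = ⟦ gap b c ⟧

    Rectangle : Fin q → Fin q → Fin r → Fin r → Set
    Rectangle b b′ c c′ = g b c + g b′ c′ ≡ g b c′ + g b′ c

    -- the cuboid sum over [0, 1] × [b, b′] × [c, c′] is the alternating sum of gap over [b, b′] × [c, c′]
    rectangle< : ∀ {b b′ c c′} → b < b′ → c < c′ → Rectangle b b′ c c′
    rectangle< {b} {b′} {c} {c′} b<b′ c<c′ = ℤ.i-j≡0⇒i≡j _ _ (begin
      (g b c + g b′ c′) - (g b c′ + g b′ c)
        ≡⟨ cong₂ _-_ (cong₂ _+_ (g≡ b c) (g≡ b′ c′)) (cong₂ _+_ (g≡ b c′) (g≡ b′ c)) ⟩
      ((v₀ b c - v₁ b c) + (v₀ b′ c′ - v₁ b′ c′)) - ((v₀ b c′ - v₁ b c′) + (v₀ b′ c - v₁ b′ c))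
        ≡⟨ regroup (v₀ b c) (v₀ b c′) (v₀ b′ c) (v₀ b′ c′) (v₁ b c) (v₁ b c′) (v₁ b′ c) (v₁ b′ c′) ⟩
      cuboidSum σ zero (suc zero) b b′ c c′
        ≡⟨ vanish z<s b<b′ c<c′ ⟩
      + 0
        ∎)
      where
      open ≡-Reasoning
      v₀ v₁ : Fin q → Fin r → ℤ
      v₀ = weight σ zero
      v₁ = weight σ (suc zero)
      g≡ : ∀ b c → g b c ≡ v₀ b c - v₁ b c
      g≡ b c = ⟦difference⟧ (σ (zero , b , c)) (σ (suc zero , b , c))
      regroup : ∀ x₀₀ x₀₁ x₁₀ x₁₁ y₀₀ y₀₁ y₁₀ y₁₁ →
        ((x₀₀ - y₀₀) + (x₁₁ - y₁₁)) - ((x₀₁ - y₀₁) + (x₁₀ - y₁₀)) ≡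
        ((x₀₀ - x₀₁) - (x₁₀ - x₁₁)) - ((y₀₀ - y₀₁) - (y₁₀ - y₁₁))
      regroup = solve-∀

    rectangle-swapRows : ∀ {b b′ c c′} → Rectangle b′ b c c′ → Rectangle b b′ c c′
    rectangle-swapRows {b} {b′} {c} {c′} R =
      trans (ℤ.+-comm (g b c) (g b′ c′)) (trans (sym R) (ℤ.+-comm (g b′ c) (g b c′)))

    rectangle : ∀ b b′ c c′ → Rectangle b b′ c c′
    rectangle b b′ c c′ with Fin.<-cmp b b′ | Fin.<-cmp c c′
    ... | tri≈ _ refl _ | _             = ℤ.+-comm (g b c) (g b c′)
    ... | _             | tri≈ _ refl _ = refl
    ... | tri< b<b′ _ _ | tri< c<c′ _ _ = rectangle< b<b′ c<c′
    ... | tri< b<b′ _ _ | tri> _ _ c′<c = sym (rectangle< b<b′ c′<c)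
    ... | tri> _ _ b′<b | tri< c<c′ _ _ = rectangle-swapRows (rectangle< b′<b c<c′)
    ... | tri> _ _ b′<b | tri> _ _ c′<c = rectangle-swapRows (sym (rectangle< b′<b c′<c))

    record Frame : Set where
      constructor frame
      field
        bP bM  : Fin q
        cP cM  : Fin r
        gap-PP : gap bP cP ≡ ⊕
        gap-MM : gap bM cM ≡ ⊖
        gap-PM : gap bP cM ≡ ⊙
        gap-MP : gap bM cP ≡ ⊙

    findFrame : ¬ ConstantRows → ¬ ConstantColumns → Frame
    findFrame nonconstantRows nonconstantColumns
      with ¬∀³⇒∃¬ (λ b c c′ → gap b c ≟ gap b c′) nonconstantRows
         | ¬∀³⇒∃¬ (λ b b′ c → gap b c ≟ gap b′ c) nonconstantColumns
    ... | b₀ , c₁ , c₂ , row≢ | b₁ , b₂ , c₀ , column≢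
      with oppositeCorners (gap b₁ c₁) (gap b₁ c₂) (gap b₂ c₁) (gap b₂ c₂) (rectangle b₁ b₂ c₁ c₂) row₁≢ column₁≢
      where
      row₁≢ : gap b₁ c₁ ≢ gap b₁ c₂
      row₁≢ eq = row≢ (⟦⟧-injective (∙-cancelʳ (g b₁ c₁) _ _
        (trans (cong (λ t → g b₀ c₁ + ⟦ t ⟧) eq) (rectangle b₀ b₁ c₁ c₂))))
      column₁≢ : gap b₁ c₁ ≢ gap b₂ c₁
      column₁≢ eq = column≢ (⟦⟧-injective (∙-cancelʳ (g b₂ c₁) _ _
        (trans (rectangle b₁ b₂ c₀ c₁) (trans (cong (λ t → ⟦ t ⟧ + g b₂ c₀) eq) (ℤ.+-comm (g b₂ c₁) (g b₂ c₀))))))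
    ... | inj₁ (pp , mm , pm , mp)               = frame b₁ b₂ c₁ c₂ pp mm pm mp
    ... | inj₂ (inj₁ (mm , pp , pm , mp))        = frame b₂ b₁ c₂ c₁ pp mm mp pm
    ... | inj₂ (inj₂ (inj₁ (pp , mm , pm , mp))) = frame b₁ b₂ c₂ c₁ pp mm pm mp
    ... | inj₂ (inj₂ (inj₂ (mm , pp , pm , mp))) = frame b₂ b₁ c₁ c₂ pp mm mp pm

    module _ (fr : Frame) where

      open Frame fr

      gap-diagonal : ∀ b c → gap b c ≡ diagonal (isZero (gap b cM)) (isZero (gap bM c))
      gap-diagonal b c = diagonal-sum (gap b c) (gap b cM) (gap bM c) through-MM
        (nonpositive (gap b cM) (gap b cP) through-PP)
        (nonpositive (gap bM c) (gap bP c) (trans through-PP′ (ℤ.+-comm ⟦ ⊙ ⟧ (g bP c))))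
        where
        through-MM : g b c + ⟦ ⊖ ⟧ ≡ g b cM + g bM c
        through-MM = subst (λ t → g b c + ⟦ t ⟧ ≡ g b cM + g bM c) gap-MM (rectangle b bM c cM)
        through-PP : g b cM + ⟦ ⊕ ⟧ ≡ g b cP + ⟦ ⊙ ⟧
        through-PP = subst₂ (λ t u → g b cM + ⟦ t ⟧ ≡ g b cP + ⟦ u ⟧) gap-PP gap-PM (rectangle b bP cM cP)
        through-PP′ : g bM c + ⟦ ⊕ ⟧ ≡ ⟦ ⊙ ⟧ + g bP c
        through-PP′ = subst₂ (λ t u → g bM c + ⟦ t ⟧ ≡ ⟦ u ⟧ + g bP c) gap-PP gap-MP (rectangle bM bP c cP)

      I : Subset 2
      I = ⁅ zero ⁆

      J : Subset q
      J = tabulate λ b → isZero (gap b cM)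

      K : Subset r
      K = tabulate λ c → isZero (gap bM c)

      private
        ∈-tabulate : ∀ {n} {f : Fin n → Bool} {i} → f i ≡ true → i ∈ tabulate f
        ∈-tabulate {f = f} {i} fi = Vec.lookup⇒[]= i (tabulate f) (trans (Vec.lookup∘tabulate f i) fi)

        ∉-tabulate : ∀ {n} {f : Fin n → Bool} {i} → f i ≡ false → i ∉ tabulate f
        ∉-tabulate {f = f} {i} fi i∈ =
          true≢false (trans (sym (trans (sym (Vec.lookup∘tabulate f i)) (Vec.[]=⇒lookup i∈))) fi)

        zero∈I : zero ∈ I
        zero∈I = x∈⁅x⁆ zero

        one∉I : suc zero ∉ I
        one∉I = x≢y⇒x∉⁅y⁆ {y = zero} λ ()

      data Cell (b : Fin q) (c : Fin r) : Set where
        inner : b ∈ J → c ∈ K → gap b c ≡ ⊕ → Cell b c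
        outer : b ∉ J → c ∉ K → gap b c ≡ ⊖ → Cell b c
        mixed : (b ∈ J → c ∉ K) → (b ∉ J → c ∈ K) → gap b c ≡ ⊙ → Cell b c

      cell : ∀ b c → Cell b c
      cell b c with isZero (gap b cM) in j | isZero (gap bM c) in k | gap-diagonal b c
      ... | true  | true  | gap≡ = inner (∈-tabulate j) (∈-tabulate k) gap≡
      ... | false | false | gap≡ = outer (∉-tabulate j) (∉-tabulate k) gap≡
      ... | true  | false | gap≡ = mixed (λ _ → ∉-tabulate k) (λ b∉ → ⊥-elim (b∉ (∈-tabulate j))) gap≡
      ... | false | true  | gap≡ = mixed (λ b∈ → ⊥-elim (∉-tabulate j b∈)) (λ _ → ∈-tabulate k) gap≡

      toBoxesOrPillars : ∀ a {b c} → σ (a , b , c) ≡ true →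
                         InDiagBoxes I J K (a , b , c) ⊎ Any ((a , b , c) ∈L_) pillars
      toBoxesOrPillars a {b} {c} σa with cell b c
      toBoxesOrPillars zero       σ₀ | inner b∈ c∈ _ = inj₁ (inj₁ (zero∈I , b∈ , c∈))
      toBoxesOrPillars (suc zero) σ₁ | inner _ _ gap⊕ =
        ⊥-elim (true≢false (trans (sym σ₁) (proj₂ (difference≡⊕ gap⊕))))
      toBoxesOrPillars zero       σ₀ | outer _ _ gap⊖ =
        ⊥-elim (true≢false (trans (sym σ₀) (proj₁ (difference≡⊖ gap⊖))))
      toBoxesOrPillars (suc zero) σ₁ | outer b∉ c∉ _ = inj₁ (inj₂ (one∉I , b∉ , c∉))
      toBoxesOrPillars a {b} {c}  σa | mixed _ _ gap⊙ =
        inj₂ (∈-pillars (σ∧σ⇒both a σa (trans (sym (level a)) σa)))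
        where
        level : ∀ a → σ (a , b , c) ≡ σ (flip a , b , c)
        level zero       = difference≡⊙ gap⊙
        level (suc zero) = sym (difference≡⊙ gap⊙)

      fromBoxesOrPillars : ∀ {a b c} → InDiagBoxes I J K (a , b , c) ⊎ Any ((a , b , c) ∈L_) pillars →
                           σ (a , b , c) ≡ true
      fromBoxesOrPillars (inj₂ x∈) = ∈-pillars⁻ x∈
      fromBoxesOrPillars {zero}     (inj₁ (inj₂ (a∉I , _))) = ⊥-elim (a∉I zero∈I)
      fromBoxesOrPillars {suc zero} (inj₁ (inj₁ (a∈I , _))) = ⊥-elim (one∉I a∈I)
      fromBoxesOrPillars {zero} {b} {c} (inj₁ (inj₁ (_ , b∈ , c∈))) with cell b c
      ... | inner _ _ gap⊕         = proj₁ (difference≡⊕ gap⊕)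
      ... | outer b∉ _ _           = ⊥-elim (b∉ b∈)
      ... | mixed b∈⇒c∉ _ _        = ⊥-elim (b∈⇒c∉ b∈ c∈)
      fromBoxesOrPillars {suc zero} {b} {c} (inj₁ (inj₂ (_ , b∉ , c∉))) with cell b c
      ... | inner b∈ _ _           = ⊥-elim (b∉ b∈)
      ... | outer _ _ gap⊖         = proj₂ (difference≡⊖ gap⊖)
      ... | mixed _ b∉⇒c∈ _        = ⊥-elim (c∉ (b∉⇒c∈ b∉))

      pillars∩boxes≡∅ : ∀ {a b c} → Both (b , c) → ¬ InDiagBoxes I J K (a , b , c)
      pillars∩boxes≡∅ {b = b} {c} (σ₀ , σ₁) x∈B with cell b c | x∈B
      ... | inner _ _ gap⊕ | _ = ⊕≢⊙ (trans (sym gap⊕) (cong₂ difference σ₀ σ₁))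
        where ⊕≢⊙ : ⊕ ≢ ⊙
              ⊕≢⊙ ()
      ... | outer _ _ gap⊖ | _ = ⊖≢⊙ (trans (sym gap⊖) (cong₂ difference σ₀ σ₁))
        where ⊖≢⊙ : ⊖ ≢ ⊙
              ⊖≢⊙ ()
      ... | mixed b∈⇒c∉ _ _ | inj₁ (_ , b∈ , c∈) = b∈⇒c∉ b∈ c∈
      ... | mixed _ b∉⇒c∈ _ | inj₂ (_ , b∉ , c∉) = c∉ (b∉⇒c∈ b∉)

      frame⇒diagBoxes : IsDiagBoxesPlusFibers (Support σ)
      frame⇒diagBoxes =
        I , J , K ,
        ((zero , zero∈I) , (suc zero , one∉I)) ,
        ((bP , ∈-tabulate (cong isZero gap-PM)) , (bM , ∉-tabulate (cong isZero gap-MM))) ,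
        ((cP , ∈-tabulate (cong isZero gap-MP)) , (cM , ∉-tabulate (cong isZero gap-MM))) ,
        pillars , pillars-disjoint ,
        All-linesWhere _ both? (λ both → λ { _ (refl , refl) → pillars∩boxes≡∅ both }) ,
        λ (a , b , c) → mk⇔ (toBoxesOrPillars a) fromBoxesOrPillars

module GridCuboids (pi pj pk ni nj nk : ℕ) (ppi : Prime pi) (ppj : Prime pj) (ppk : Prime pk) where

  open Annihilation using (CoversProperDivisors)
  open ThreePrimeDivisors
  open ResidueBoxes
  open CuboidSums
  open import Data.Nat as ℕ using (suc; _+_; _*_; _^_; NonZero)
  import Data.Nat.Properties as ℕ
  open import Data.Nat.Tactic.RingSolver using (solve-∀)
  open import Data.Nat.Divisibility using (_∣_; divides; ∣-trans; n∣m*n)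
  open import Data.Nat.Primality using (prime⇒nonZero)
  open import Data.Integer using (+_; _-_)
  open import Data.Fin using (Fin; toℕ)
  open import Data.Fin.Subset using (Subset)
  open import Data.Vec using (lookup)
  open import Data.List using (_∷_; [])
  open import Data.List.Relation.Unary.Any using (here; there)
  open import Data.List.Relation.Unary.All using ([]; _∷_)
  open import Data.Product using (_,_)
  open import Data.Sum using (_⊎_; inj₁; inj₂)
  open import Relation.Binary.PropositionalEquality using (_≡_; _≢_; refl; sym; trans; cong; cong₂)

  M mi mj mk : ℕ
  M  = M3 pi pj pk (suc ni) (suc nj) (suc nk)
  mi = pi ^ ni * pj ^ suc nj * pk ^ suc nk
  mj = pi ^ suc ni * pj ^ nj * pk ^ suc nk
  mk = pi ^ suc ni * pj ^ suc nj * pk ^ nk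

  nonZero : NonZero M
  nonZero = M3-nonZero (suc ni) (suc nj) (suc nk) ppi ppj ppk

  private
    *³-nonZero : ∀ {x y z} → NonZero x → NonZero y → NonZero z → NonZero (x * y * z)
    *³-nonZero {x} {y} {z} x≢0 y≢0 z≢0 = ℕ.m*n≢0 (x * y) z {{ℕ.m*n≢0 x y {{x≢0}} {{y≢0}}}} {{z≢0}}

    instance
      _ = nonZero
      _ = prime⇒nonZero ppi
      _ = prime⇒nonZero ppj
      _ = prime⇒nonZero ppk
      mi≢0 : NonZero mi
      mi≢0 = *³-nonZero (ℕ.m^n≢0 pi ni) (ℕ.m^n≢0 pj (suc nj)) (ℕ.m^n≢0 pk (suc nk))
      mj≢0 : NonZero mj
      mj≢0 = *³-nonZero (ℕ.m^n≢0 pi (suc ni)) (ℕ.m^n≢0 pj nj) (ℕ.m^n≢0 pk (suc nk))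
      mk≢0 : NonZero mk
      mk≢0 = *³-nonZero (ℕ.m^n≢0 pi (suc ni)) (ℕ.m^n≢0 pj (suc nj)) (ℕ.m^n≢0 pk nk)

  pi*mi≡M : pi * mi ≡ M
  pi*mi≡M = rearrange pi (pi ^ ni) (pj ^ suc nj) (pk ^ suc nk)
    where
    rearrange : ∀ p x y z → p * (x * y * z) ≡ p * x * y * z
    rearrange = solve-∀

  pj*mj≡M : pj * mj ≡ M
  pj*mj≡M = rearrange pj (pi ^ suc ni) (pj ^ nj) (pk ^ suc nk)
    where
    rearrange : ∀ p x y z → p * (x * y * z) ≡ x * (p * y) * z
    rearrange = solve-∀

  pk*mk≡M : pk * mk ≡ M
  pk*mk≡M = rearrange pk (pi ^ suc ni) (pj ^ suc nj) (pk ^ nk)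
    where
    rearrange : ∀ p x y z → p * (x * y * z) ≡ x * y * (p * z)
    rearrange = solve-∀

  properDivisor-∣ : ∀ {d} → d ∣ M → d ≢ M → d ∣ mi ⊎ d ∣ mj ⊎ d ∣ mk
  properDivisor-∣ {d} (divides e M≡ed) d≢M
    with prime-∣-nontrivialDivisor {a = suc ni} {suc nj} {suc nk} ppi ppj ppk (divides d (trans M≡ed (ℕ.*-comm e d)))
                                   (λ { refl → d≢M (sym (trans M≡ed (ℕ.*-identityˡ d))) })
  ... | inj₁ pi∣e        = inj₁ (∣-cofactor (trans pi*mi≡M M≡ed) pi∣e)
  ... | inj₂ (inj₁ pj∣e) = inj₂ (inj₁ (∣-cofactor (trans pj*mj≡M M≡ed) pj∣e))
  ... | inj₂ (inj₂ pk∣e) = inj₂ (inj₂ (∣-cofactor (trans pk*mk≡M M≡ed) pk∣e))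

  cofactorMultiples-cover : ∀ ti tj tk → CoversProperDivisors M (suc ti * mi ∷ suc tj * mj ∷ suc tk * mk ∷ [])
  cofactorMultiples-cover ti tj tk d∣M d≢M with properDivisor-∣ d∣M d≢M
  ... | inj₁ d∣mi        = here (∣-trans d∣mi (n∣m*n (suc ti)))
  ... | inj₂ (inj₁ d∣mj) = there (here (∣-trans d∣mj (n∣m*n (suc tj))))
  ... | inj₂ (inj₂ d∣mk) = there (there (here (∣-trans d∣mk (n∣m*n (suc tk)))))

  module _ (A : Subset M) (x0 : Fin M) where

    σ : Pt pi pj pk → Bool
    σ x = lookup A (gridPt M nonZero x0 mi mj mk x)

    private
      gridℕ : ℕ → ℕ → ℕ → ℕ
      gridℕ α β γ = toℕ x0 + α * mi + β * mj + γ * mk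

      gridℕ-moveᵢ : ∀ {α α′} t → suc α + t ≡ α′ → ∀ β γ → gridℕ α β γ + suc t * mi ≡ gridℕ α′ β γ
      gridℕ-moveᵢ {α} t refl β γ = move (toℕ x0) α β γ t mi mj mk
        where
        move : ∀ x α β γ t m₁ m₂ m₃ →
               x + α * m₁ + β * m₂ + γ * m₃ + suc t * m₁ ≡ x + (suc α + t) * m₁ + β * m₂ + γ * m₃
        move = solve-∀

      gridℕ-moveⱼ : ∀ {β β′} t → suc β + t ≡ β′ → ∀ α γ → gridℕ α β γ + suc t * mj ≡ gridℕ α β′ γ
      gridℕ-moveⱼ {β} t refl α γ = move (toℕ x0) α β γ t mi mj mk
        where
        move : ∀ x α β γ t m₁ m₂ m₃ →
               x + α * m₁ + β * m₂ + γ * m₃ + suc t * m₂ ≡ x + α * m₁ + (suc β + t) * m₂ + γ * m₃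
        move = solve-∀

      gridℕ-moveₖ : ∀ {γ γ′} t → suc γ + t ≡ γ′ → ∀ α β → gridℕ α β γ + suc t * mk ≡ gridℕ α β γ′
      gridℕ-moveₖ {γ} t refl α β = move (toℕ x0) α β γ t mi mj mk
        where
        move : ∀ x α β γ t m₁ m₂ m₃ →
               x + α * m₁ + β * m₂ + γ * m₃ + suc t * m₃ ≡ x + α * m₁ + β * m₂ + (suc γ + t) * m₃
        move = solve-∀

      _⨾_ : ∀ {x y z s} → x ≡ y → y + s ≡ z → x + s ≡ z
      x≡y ⨾ y+s≡z = trans (cong (_+ _) x≡y) y+s≡z
      infixl 5 _⨾_

    gridCuboidSums : Φ[ M ]∣ maskPoly A → CuboidSumsVanish σ
    gridCuboidSums Φ∣A {a} {a′} {b} {b′} {c} {c′} a<a′ b<b′ c<c′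
      with ti , a′≡ ← ℕ.m≤n⇒∃[o]m+o≡n a<a′
         | tj , b′≡ ← ℕ.m≤n⇒∃[o]m+o≡n b<b′
         | tk , c′≡ ← ℕ.m≤n⇒∃[o]m+o≡n c<c′ =
      trans (sym vertices)
            (Φ∣mask⇒boxSum≡0 M A Φ∣A (suc ti * mi ∷ suc tj * mj ∷ suc tk * mk ∷ [])
              (ℕ.m*n≢0 (suc ti) mi ∷ ℕ.m*n≢0 (suc tj) mj ∷ ℕ.m*n≢0 (suc tk) mk ∷ [])
              (cofactorMultiples-cover ti tj tk) (gridℕ α₀ β₀ γ₀))
      where
      α₀ = toℕ a
      α₁ = toℕ a′
      β₀ = toℕ b
      β₁ = toℕ b′
      γ₀ = toℕ c
      ↑i = gridℕ-moveᵢ ti a′≡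
      ↑j = gridℕ-moveⱼ tj b′≡
      ↑k = gridℕ-moveₖ tk c′≡
      at = cong (maskAt M A)

      vertices : boxSum (maskAt M A) (gridℕ α₀ β₀ γ₀) (suc ti * mi ∷ suc tj * mj ∷ suc tk * mk ∷ []) ≡
                 cuboidSum σ a a′ b b′ c c′
      vertices =
        cong₂ _-_ (cong₂ _-_ (cong₂ _-_ (refl {x = maskAt M A (gridℕ α₀ β₀ γ₀)}) (at (↑k α₀ β₀)))
                             (cong₂ _-_ (at (↑j α₀ γ₀)) (at (↑j α₀ γ₀ ⨾ ↑k α₀ β₁))))
                  (cong₂ _-_ (cong₂ _-_ (at (↑i β₀ γ₀)) (at (↑i β₀ γ₀ ⨾ ↑k α₁ β₀)))
                             (cong₂ _-_ (at (↑i β₀ γ₀ ⨾ ↑j α₁ γ₀)) (at (↑i β₀ γ₀ ⨾ ↑j α₁ γ₀ ⨾ ↑k α₁ β₁))))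

open import Data.Nat using (_≤_; _∸_; _*_; _^_; suc; s≤s; z≤n)
open import Data.Fin using (Fin)
open import Data.Fin.Subset using (Subset; _∈_)
open import Data.Vec.Properties using (lookup⇒[]=; []=⇒lookup)
open import Data.Sum using (_⊎_; inj₁; inj₂)
open import Data.Empty using (⊥-elim)
open import Function using (_∘_)
open import Function.Bundles using (_⇔_; mk⇔)
open import Relation.Nullary using (¬_; yes; no)
open import Relation.Binary.PropositionalEquality using (_≡_; _≢_; refl)
open FiberSets using (Support; Relabelling; fiberUnion-relabel; diagBoxes-relabel; fiberUnion-cong; diagBoxes-cong)
open CoordinateSwaps using (swap₁₂; swap₁₃; swap₂₃)
open CuboidSums using (CuboidSumsVanish; cuboidSums-swap₁₂; cuboidSums-swap₁₃)
open TwoLayers using (constantRows?; constantColumns?; constantRows⇒fiberUnion; findFrame; frame⇒diagBoxes)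
open Relabelling using (point)

twoLayers : ∀ {q r} (σ : Pt 2 q r → Bool) → CuboidSumsVanish σ →
            ¬ IsDisjointFiberUnion (Support σ) → IsDiagBoxesPlusFibers (Support σ)
twoLayers σ vanish notFibers with constantRows? σ | constantColumns? σ
... | yes rows | _           = ⊥-elim (notFibers (constantRows⇒fiberUnion σ rows))
... | no _     | yes columns = ⊥-elim (notFibers (fiberUnion-relabel swap₂₃
      (constantRows⇒fiberUnion (σ ∘ point swap₂₃) λ c b b′ → columns b b′ c)))
... | no nonconstantRows | no nonconstantColumns =
      frame⇒diagBoxes σ vanish (findFrame σ vanish nonconstantRows nonconstantColumns)

someLayerPair : ∀ {p q r} (σ : Pt p q r → Bool) → CuboidSumsVanish σ → p ≡ 2 ⊎ q ≡ 2 ⊎ r ≡ 2 →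
                ¬ IsDisjointFiberUnion (Support σ) → IsDiagBoxesPlusFibers (Support σ)
someLayerPair σ vanish (inj₁ refl)        notFibers = twoLayers σ vanish notFibers
someLayerPair σ vanish (inj₂ (inj₁ refl)) notFibers = diagBoxes-relabel swap₁₂
  (twoLayers (σ ∘ point swap₁₂) (cuboidSums-swap₁₂ σ vanish) (notFibers ∘ fiberUnion-relabel swap₁₂))
someLayerPair σ vanish (inj₂ (inj₂ refl)) notFibers = diagBoxes-relabel swap₁₃
  (twoLayers (σ ∘ point swap₁₃) (cuboidSums-swap₁₃ σ vanish) (notFibers ∘ fiberUnion-relabel swap₁₃))

proposition8p5 :
    (pi pj pk ni nj nk : ℕ) →
    (ppi : Prime pi) → (ppj : Prime pj) → (ppk : Prime pk) →
    pi ≢ pj → pi ≢ pk → pj ≢ pk →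
    1 ≤ ni → 1 ≤ nj → 1 ≤ nk →
    (pi ≡ 2 ⊎ pj ≡ 2 ⊎ pk ≡ 2) →
    (A : Subset (M3 pi pj pk ni nj nk)) →
    Φ[ M3 pi pj pk ni nj nk ]∣ maskPoly A →
    (x0 : Fin (M3 pi pj pk ni nj nk)) →
    ¬ IsDisjointFiberUnion {pi} {pj} {pk}
        (λ λs → gridPt (M3 pi pj pk ni nj nk) (M3-nonZero ni nj nk ppi ppj ppk) x0
                  (pi ^ (ni ∸ 1) * pj ^ nj * pk ^ nk)
                  (pi ^ ni * pj ^ (nj ∸ 1) * pk ^ nk)
                  (pi ^ ni * pj ^ nj * pk ^ (nk ∸ 1)) λs ∈ A) →
    IsDiagBoxesPlusFibers {pi} {pj} {pk}
        (λ λs → gridPt (M3 pi pj pk ni nj nk) (M3-nonZero ni nj nk ppi ppj ppk) x0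
                  (pi ^ (ni ∸ 1) * pj ^ nj * pk ^ nk)
                  (pi ^ ni * pj ^ (nj ∸ 1) * pk ^ nk)
                  (pi ^ ni * pj ^ nj * pk ^ (nk ∸ 1)) λs ∈ A)
-- the argument does not need the primes to be distinct
proposition8p5 pi pj pk (suc ni) (suc nj) (suc nk) ppi ppj ppk _ _ _ (s≤s z≤n) (s≤s z≤n) (s≤s z≤n)
               someTwo A Φ∣A x0 notFibers =
  diagBoxes-cong support⇔
    (someLayerPair (σ A x0) (gridCuboidSums A x0 Φ∣A) someTwo (notFibers ∘ fiberUnion-cong support⇔))
  where
  open GridCuboids pi pj pk ni nj nk ppi ppj ppk
  support⇔ : ∀ x → Support (σ A x0) x ⇔ gridPt M nonZero x0 mi mj mk x ∈ A
  support⇔ x = mk⇔ (lookup⇒[]= (gridPt M nonZero x0 mi mj mk x) A) []=⇒lookup
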